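{- Let $G=(V,E)$ be a graph with $n=|V|$ vertices and $m=|E|$ edges, let $k$ be an integer with $0\le k\le n$, and let ${\bf s}^{(1)}$ be the string associated to $G$ as described in the context. Then $G$ has a vertex cover of size $k$ if and only if there exists a $1$-BLZ parsing of ${\bf s}^{(1)}$ of size $4n+6m+k$.
   Context: Strings: for ${\bf s}=s_1\dots s_N$ and $1\le i\le j\le N$, ${\bf s}[i,j]=s_i\dots s_j$. A parsing of ${\bf s}$ is a partition of ${\bf s}$ into consecutive nonempty substrings called phrases; its size is the number of phrases. An LZ-parsing is a parsing in which every phrase ${\bf s}[a,e]$ either has length $1$, or is given together with a chosen source start $b$ with $1\le b\le a-1$ and ${\bf s}[b,b+(e-a)-1]={\bf s}[a,e-1]$ (the source may overlap the phrase). For such a phrase, each position $a+t$ with $0\le t\le e-a-1$ has source position $b+(t \bmod (a-b))$. The hop-number of a position $p$ is $hop(p)=0$ if $p$ is the last position of a phrase, and $hop(p)=hop(q)+1$ where $q<p$ is the source position of $p$ otherwise. A $c$-BLZ parsing is an LZ-parsing in which every position has hop-number at most $c$. Construction: $G=(V,E)$ is a simple undirected graph with $V=\{v_1,\dots,v_n\}$, $E=\{e_1,\dots,e_m\}$; for each edge $e_i$ fix an ordering $(v_p,v_q)$ of its endpoints. Use pairwise distinct symbols $v_i,v_i',\#^v_i$ ($i\in[n]$), $e_i,\$_i,\#^e_i$ ($i\in[m]$), $\#^p_t$ ($t\in[n+m]$). Define $P=v_1\#^p_1 v_2\#^p_2\cdots v_n\#^p_n e_1\#^p_{n+1}e_2\#^p_{n+2}\cdots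 e_m\#^p_{n+m}$; $X_i=v_i'\,v_i\,\#^v_i$ and $X=X_1X_2\cdots X_n$; for $e_i=(v_p,v_q)$, $Y_i=v_p'\,v_p\,e_i\,\$_i\,v_q'\,v_q\,e_i\,\$_i\,\#^e_i$ and $Y=Y_1\cdots Y_m$; finally ${\bf s}^{(1)}=PXY$. A vertex cover of $G$ is a set $C\subseteq V$ meeting every edge. -}

module Defs where

open import Data.Nat using (ℕ; zero; suc; _+_; _*_; _∸_; _≤_; _<_; _%_)
open import Data.Fin using (Fin; _↑ˡ_; _↑ʳ_)
open import Data.Fin.Subset using (Subset; _∈_; ∣_∣)
open import Data.List using (List; []; _∷_; _++_; concatMap; allFin; length; map)
open import Data.Nat.ListAction using (sum)
open import Data.List.Relation.Unary.All using (All)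
open import Data.Maybe using (Maybe; just; nothing)
open import Data.Product using (_×_; _,_; proj₁; proj₂; Σ; ∃)
open import Data.Sum using (_⊎_)
open import Relation.Binary.PropositionalEquality using (_≡_; _≢_)
import Data.List.Membership.Propositional as LM

-- at s i = s_i (1-based); nothing if out of range
at : {A : Set} → List A → ℕ → Maybe A
at []       _             = nothing
at (x ∷ xs) zero          = nothing
at (x ∷ xs) (suc zero)    = just x
at (x ∷ xs) (suc (suc i)) = at xs (suc i)

-- A phrase is given by its length and a chosen source start.
-- (For phrases of length 1 the source field is irrelevant.)
record Phrase : Set where
  constructor phrase
  field
    len : ℕ
    src : ℕ
open Phrase public

Parsing : Set
Parsing = List Phrase

size : Parsing → ℕ
size = length

-- The phrases as triples (a , e , b): phrase s[a,e] with source start b,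
-- where the first phrase starts at position `a`.
spans : ℕ → Parsing → List (ℕ × ℕ × ℕ)
spans a []       = []
spans a (ph ∷ P) = (a , a + len ph ∸ 1 , src ph) ∷ spans (a + len ph) P

triples : Parsing → List (ℕ × ℕ × ℕ)
triples = spans 1

IsParsing : {A : Set} → List A → Parsing → Set
IsParsing s P = All (λ ph → 1 ≤ len ph) P × sum (map len P) ≡ length s

ValidLZPhrase : {A : Set} → List A → ℕ × ℕ × ℕ → Set
ValidLZPhrase s (a , e , b) =
  e ≡ a ⊎ (1 ≤ b × b < a × (∀ t → t < e ∸ a → at s (b + t) ≡ at s (a + t)))

IsLZParsing : {A : Set} → List A → Parsing → Set
IsLZParsing s P = IsParsing s P × All (ValidLZPhrase s) (triples P)

-- x mod d (only used with d ≥ 1)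
modP : ℕ → ℕ → ℕ
modP x zero    = x
modP x (suc d) = x % suc d

data Hop (P : Parsing) : ℕ → ℕ → Set where
  hop-last : ∀ {a e b} → (a , e , b) LM.∈ triples P → Hop P e 0
  hop-step : ∀ {a e b p h} → (a , e , b) LM.∈ triples P → a ≤ p → p < e →
             Hop P (b + modP (p ∸ a) (a ∸ b)) h → Hop P p (suc h)

IsBLZ : {A : Set} → ℕ → List A → Parsing → Set
IsBLZ c s P = IsLZParsing s P ×
  (∀ p → 1 ≤ p → p ≤ length s → Σ ℕ (λ h → h ≤ c × Hop P p h))

-- A graph on vertices Fin n with m edges, each edge e_i given with a fixed
-- ordering (v_p , v_q) of its endpoints.
Edges : ℕ → ℕ → Set
Edges n m = Fin m → Fin n × Fin n

IsSimple : {n m : ℕ} → Edges n m → Set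
IsSimple {n} {m} E =
  (∀ i → proj₁ (E i) ≢ proj₂ (E i)) ×
  (∀ i j → i ≢ j → E i ≢ E j × E i ≢ (proj₂ (E j) , proj₁ (E j)))

IsVertexCover : {n m : ℕ} → Edges n m → Subset n → Set
IsVertexCover E C = ∀ i → proj₁ (E i) ∈ C ⊎ proj₂ (E i) ∈ C

HasVertexCoverOfSize : {n m : ℕ} → Edges n m → ℕ → Set
HasVertexCoverOfSize {n} E k = Σ (Subset n) (λ C → ∣ C ∣ ≡ k × IsVertexCover E C)

data Sym (n m : ℕ) : Set where
  vS  : Fin n → Sym n m
  v′S : Fin n → Sym n m
  #v  : Fin n → Sym n m
  eS  : Fin m → Sym n m
  $S  : Fin m → Sym n m
  #e  : Fin m → Sym n m
  #p  : Fin (n + m) → Sym n m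

strP : (n m : ℕ) → List (Sym n m)
strP n m = concatMap (λ i → vS i ∷ #p (i ↑ˡ m) ∷ []) (allFin n)
        ++ concatMap (λ j → eS j ∷ #p (n ↑ʳ j) ∷ []) (allFin m)

strX : (n m : ℕ) → List (Sym n m)
strX n m = concatMap (λ i → v′S i ∷ vS i ∷ #v i ∷ []) (allFin n)

strYi : {n m : ℕ} → Edges n m → Fin m → List (Sym n m)
strYi E i = v′S p ∷ vS p ∷ eS i ∷ $S i ∷ v′S q ∷ vS q ∷ eS i ∷ $S i ∷ #e i ∷ []
  where p = proj₁ (E i)
        q = proj₂ (E i)

strY : {n m : ℕ} → Edges n m → List (Sym n m)
strY {n} {m} E = concatMap (strYi E) (allFin m)

s1 : {n m : ℕ} → Edges n m → List (Sym n m)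
s1 {n} {m} E = strP n m ++ strX n m ++ strY E

{-# OPTIONS --safe #-}
{-
The last position of a phrase is a phrase end, and a position holding the first
occurrence of a symbol must be one. Hence all positions of P, the v′ᵢ and #ᵛᵢ of every Xᵢ and the
$ⱼ and #ᵉⱼ of every Yⱼ are ends; moreover the factors vₚeⱼ and v_q eⱼ of Yⱼ occur nowhere earlier
(the graph is simple), so each of them contains an end. This gives 2 ends in every Xᵢ and 4 in
every Yⱼ, i.e. 4n + 6m phrases. If Yⱼ has no further end, then v′ₚvₚ or v′_q v_q is the copied
prefix of a phrase of length 3; as hops are at most 1, both its sources are phrase ends, so both
positions of some earlier occurrence of v′ᵥvᵥ are ends. This is an extra end of X_v or of another
edge block, and charging every extra end to a vertex gives a vertex cover with at most
size − (4n + 6m) vertices, which is then padded to size exactly k.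

For a cover C parse P symbol by symbol, Xᵢ as v′ᵢ|vᵢ|#ᵛᵢ if vᵢ ∈ C and as v′ᵢ|vᵢ#ᵛᵢ
otherwise, and Yⱼ as v′ₚvₚeⱼ|$ⱼ|v′_q v_q|eⱼ$ⱼ#ᵉⱼ if vₚ ∈ C and as v′ₚvₚ|eⱼ$ⱼ|v′_q v_q eⱼ|$ⱼ#ᵉⱼ
otherwise (then v_q ∈ C). Every copied position then has a phrase end as its source, so all hops
are at most 1.
-}
module Submission where

open import Defs
open import Data.Bool using (Bool; true; false)
import Data.Bool as Bool
open import Data.Empty using (⊥; ⊥-elim)
open import Data.Fin using (Fin; toℕ; zero; suc; _↑ˡ_; _↑ʳ_; fromℕ<)
open import Data.Fin.Properties using (toℕ<n; toℕ-↑ˡ; toℕ-↑ʳ; toℕ-fromℕ<)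
open import Data.Fin.Subset as Subset using (Subset; ⁅_⁆; _∪_; _⊆_; ∣_∣) renaming (_∈_ to _∈ₛ_)
open import Data.Fin.Subset.Properties using (∪-identityʳ; x∈⁅x⁆; x∈p∪q⁺; ∣p∣≤n; ∣⊥∣≡0)
open import Data.List using (List; []; _∷_; _++_; concat; concatMap; allFin; length; tabulate; map; replicate)
open import Data.List.Properties using (++-assoc; ++-identityʳ; length-++; length-map; length-replicate; map-++; tabulate-cong)
open import Data.List.Membership.Propositional using (_∈_; lose)
open import Data.List.Membership.Propositional.Properties
  using (∈-map⁺; ∈-map⁻; ∈-++⁺ˡ; ∈-++⁺ʳ; ∈-concat⁺′; ∈-concatMap⁺; ∈-tabulate⁺; ∈-allFin)
open import Data.List.Relation.Unary.All using (All; []; _∷_)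
import Data.List.Relation.Unary.All as All
open import Data.List.Relation.Unary.All.Properties using (++⁺; concat⁺; tabulate⁺; map⁺)
open import Data.List.Relation.Unary.Any using (here; there)
open import Data.Maybe using (just)
open import Data.Maybe.Properties using (just-injective)
open import Data.Nat
open import Data.Nat.DivMod using (m<n⇒m%n≡m)
open import Data.Nat.ListAction using (sum)
open import Data.Nat.ListAction.Properties using (sum-++)
open import Data.Nat.Properties
open import Data.Nat.Tactic.RingSolver using (solve-∀)
open import Data.List.Membership.DecPropositional _≟_ using (_∈?_)
open import Data.Product using (Σ; _×_; _,_; proj₁; proj₂)
open import Data.Sum using (_⊎_; inj₁; inj₂; [_,_]′)
import Data.Sum as Sum
open import Data.Vec using (lookup; []; _∷_; here; there)
open import Data.Vec.Properties using ([]=⇒lookup)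
open import Function using (id; _∘_; case_of_)
open import Function.Bundles using (_⇔_; mk⇔)
open import Relation.Binary.PropositionalEquality
open import Relation.Nullary using (Dec; yes; no; ¬_)

at-bounds : {A : Set} (xs : List A) (u : ℕ) {c : A} → at xs u ≡ just c → 1 ≤ u × u ≤ length xs
at-bounds (x ∷ xs) (suc zero) _ = s≤s z≤n , s≤s z≤n
at-bounds (x ∷ xs) (suc (suc u)) eq = s≤s z≤n , s≤s (proj₂ (at-bounds xs (suc u) eq))

at-++ˡ : {A : Set} (xs ys : List A) {u : ℕ} → 1 ≤ u → u ≤ length xs → at (xs ++ ys) u ≡ at xs u
at-++ˡ (x ∷ xs) ys {suc zero} _ _ = refl
at-++ˡ (x ∷ xs) ys {suc (suc u)} _ (s≤s u<) = at-++ˡ xs ys (s≤s z≤n) u<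

at-++ʳ : {A : Set} (xs ys : List A) {u : ℕ} → 1 ≤ u → at (xs ++ ys) (u + length xs) ≡ at ys u
at-++ʳ [] ys {u} _ = cong (at ys) (+-identityʳ u)
at-++ʳ (x ∷ xs) ys {suc u} _ =
  trans (cong (at (x ∷ xs ++ ys)) (+-suc (suc u) (length xs))) (at-++ʳ xs ys (s≤s z≤n))

at-concatMap : {A B : Set} (c : ℕ) (f : B → List A) → (∀ x → length (f x) ≡ c) →
  ∀ {k} (g : Fin k → B) (i : Fin k) (rest : List A) {t : ℕ} → 1 ≤ t → t ≤ c →
  at (concatMap f (tabulate g) ++ rest) (t + c * toℕ i) ≡ at (f (g i)) t
at-concatMap c f len-f g zero rest {t} 1≤t t≤c = begin
    at (concatMap f (tabulate g) ++ rest) (t + c * 0)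
  ≡⟨ cong₂ at (++-assoc (f (g zero)) _ rest) (trans (cong (t +_) (*-zeroʳ c)) (+-identityʳ t)) ⟩
    at (f (g zero) ++ _) t
  ≡⟨ at-++ˡ (f (g zero)) _ 1≤t (subst (t ≤_) (sym (len-f (g zero))) t≤c) ⟩
    at (f (g zero)) t ∎
  where open ≡-Reasoning
at-concatMap c f len-f g (suc i) rest {t} 1≤t t≤c = begin
    at (concatMap f (tabulate g) ++ rest) (t + c * suc (toℕ i))
  ≡⟨ cong₂ at (++-assoc (f (g zero)) _ rest) shift ⟩
    at (f (g zero) ++ (concatMap f (tabulate (λ x → g (suc x))) ++ rest)) (t + c * toℕ i + length (f (g zero)))
  ≡⟨ at-++ʳ (f (g zero)) _ (≤-trans 1≤t (m≤m+n t _)) ⟩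
    at (concatMap f (tabulate (λ x → g (suc x))) ++ rest) (t + c * toℕ i)
  ≡⟨ at-concatMap c f len-f (λ x → g (suc x)) i rest 1≤t t≤c ⟩
    at (f (g (suc i))) t ∎
  where
  open ≡-Reasoning
  shift : t + c * suc (toℕ i) ≡ t + c * toℕ i + length (f (g zero))
  shift rewrite len-f (g zero) = ring t c (toℕ i)
    where ring : ∀ t c i → t + c * suc i ≡ t + c * i + c
          ring = solve-∀

block-decomposition : (c k x : ℕ) → 1 ≤ x → x ≤ c * k →
  Σ (Fin k) λ i → Σ ℕ λ t → 1 ≤ t × t ≤ c × x ≡ t + c * toℕ i
block-decomposition c zero x 1≤x x≤0 = ⊥-elim (<⇒≱ 1≤x (subst (x ≤_) (*-zeroʳ c) x≤0))
block-decomposition c (suc k) x 1≤x x≤ with x ≤? c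
... | yes x≤c = zero , x , 1≤x , x≤c , sym (trans (cong (x +_) (*-zeroʳ c)) (+-identityʳ x))
... | no x≰c with block-decomposition c k (x ∸ c) (m<n⇒0<n∸m (≰⇒> x≰c))
                    (subst (x ∸ c ≤_) (m+n∸m≡n c (c * k)) (∸-monoˡ-≤ c (subst (x ≤_) (*-suc c k) x≤)))
...   | i , t , 1≤t , t≤c , eq = suc i , t , 1≤t , t≤c , (begin
        x                 ≡⟨ sym (m∸n+n≡m (<⇒≤ (≰⇒> x≰c))) ⟩
        x ∸ c + c         ≡⟨ cong (_+ c) eq ⟩
        t + c * toℕ i + c ≡⟨ ring t c (toℕ i) ⟩
        t + c * suc (toℕ i) ∎)
  where
  open ≡-Reasoning
  ring : ∀ t c i → t + c * i + c ≡ t + c * suc i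
  ring = solve-∀

split-range : (a b x : ℕ) → x ≤ a + b → x ≤ a ⊎ Σ ℕ λ x′ → 1 ≤ x′ × x′ ≤ b × x ≡ x′ + a
split-range a b x x≤ with x ≤? a
... | yes x≤a = inj₁ x≤a
... | no x≰a = inj₂ (x ∸ a , m<n⇒0<n∸m (≰⇒> x≰a) ,
      subst (x ∸ a ≤_) (m+n∸m≡n a b) (∸-monoˡ-≤ a x≤) , sym (m∸n+n≡m (<⇒≤ (≰⇒> x≰a))))

block-end : (c : ℕ) {k : ℕ} (i : Fin k) {t : ℕ} → t ≤ c → t + c * toℕ i ≤ c * k
block-end c {k} i {t} t≤c = begin
  t + c * toℕ i     ≤⟨ +-monoˡ-≤ (c * toℕ i) t≤c ⟩
  c + c * toℕ i     ≡⟨ sym (*-suc c (toℕ i)) ⟩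
  c * suc (toℕ i)   ≤⟨ *-monoʳ-≤ c (toℕ<n i) ⟩
  c * k ∎
  where open ≤-Reasoning

∑ : (k : ℕ) → (Fin k → ℕ) → ℕ
∑ zero    f = 0
∑ (suc k) f = f zero + ∑ k (λ i → f (suc i))

∑-mono : ∀ k {f g : Fin k → ℕ} → (∀ i → f i ≤ g i) → ∑ k f ≤ ∑ k g
∑-mono zero    f≤g = z≤n
∑-mono (suc k) f≤g = +-mono-≤ (f≤g zero) (∑-mono k (λ i → f≤g (suc i)))

∑-cong : ∀ k {f g : Fin k → ℕ} → (∀ i → f i ≡ g i) → ∑ k f ≡ ∑ k g
∑-cong zero    f≡g = refl
∑-cong (suc k) f≡g = cong₂ _+_ (f≡g zero) (∑-cong k (λ i → f≡g (suc i)))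

∑-const+ : ∀ k c (f : Fin k → ℕ) → ∑ k (λ i → c + f i) ≡ c * k + ∑ k f
∑-const+ zero c f = sym (trans (+-identityʳ (c * 0)) (*-zeroʳ c))
∑-const+ (suc k) c f
  rewrite ∑-const+ k c (λ i → f (suc i)) | *-suc c k = ring c (f zero) (c * k) (∑ k (λ i → f (suc i)))
  where ring : ∀ a b c d → a + b + (c + d) ≡ a + c + (b + d)
        ring = solve-∀

∑-const : ∀ k c → ∑ k (λ _ → c) ≡ c * k
∑-const zero    c = sym (*-zeroʳ c)
∑-const (suc k) c = trans (cong (c +_) (∑-const k c)) (sym (*-suc c k))

additive-concatMap : {A B : Set} (h : List A → ℕ) → h [] ≡ 0 → (∀ xs ys → h (xs ++ ys) ≡ h xs + h ys) →
  (f : B → List A) {k : ℕ} (g : Fin k → B) → h (concatMap f (tabulate g)) ≡ ∑ k (λ i → h (f (g i)))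
additive-concatMap h h-[] h-++ f {zero}  g = h-[]
additive-concatMap h h-[] h-++ f {suc k} g =
  trans (h-++ (f (g zero)) _) (cong (h (f (g zero)) +_) (additive-concatMap h h-[] h-++ f (λ i → g (suc i))))

additive-concatMap-const : {A B : Set} (h : List A → ℕ) → h [] ≡ 0 → (∀ xs ys → h (xs ++ ys) ≡ h xs + h ys) →
  (c : ℕ) (f : B → List A) → (∀ x → h (f x) ≡ c) →
  {k : ℕ} (g : Fin k → B) → h (concatMap f (tabulate g)) ≡ c * k
additive-concatMap-const h h-[] h-++ c f h-f {k} g =
  trans (additive-concatMap h h-[] h-++ f g) (trans (∑-cong k (λ i → h-f (g i))) (∑-const k c))

length-concatMap : {A B : Set} (f : B → List A) {k : ℕ} (g : Fin k → B) →
  length (concatMap f (tabulate g)) ≡ ∑ k (λ i → length (f (g i)))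
length-concatMap = additive-concatMap length refl (λ xs _ → length-++ xs)

length-concatMap-const : {A B : Set} (c : ℕ) (f : B → List A) → (∀ x → length (f x) ≡ c) →
  {k : ℕ} (g : Fin k → B) → length (concatMap f (tabulate g)) ≡ c * k
length-concatMap-const = additive-concatMap-const length refl (λ xs _ → length-++ xs)

𝟙 : {P : Set} → Dec P → ℕ
𝟙 (yes _) = 1
𝟙 (no _)  = 0

𝟙≤1 : {P : Set} (d : Dec P) → 𝟙 d ≤ 1
𝟙≤1 (yes _) = s≤s z≤n
𝟙≤1 (no _)  = z≤n

𝟙-yes : {P : Set} (d : Dec P) → P → 𝟙 d ≡ 1
𝟙-yes (yes _) _  = refl
𝟙-yes (no ¬p) p = ⊥-elim (¬p p)

𝟙-no : {P : Set} (d : Dec P) → ¬ P → 𝟙 d ≡ 0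
𝟙-no (yes p) ¬p = ⊥-elim (¬p p)
𝟙-no (no _)  _  = refl

𝟙≡0⇒ : {P : Set} (d : Dec P) → 𝟙 d ≡ 0 → ¬ P
𝟙≡0⇒ (no ¬p) _ = ¬p

countIn : List ℕ → ℕ → ℕ → ℕ
countIn L lo zero    = 0
countIn L lo (suc k) = 𝟙 (lo ∈? L) + countIn L (suc lo) k

countIn-+ : ∀ L lo a b → countIn L lo (a + b) ≡ countIn L lo a + countIn L (lo + a) b
countIn-+ L lo zero b rewrite +-identityʳ lo = refl
countIn-+ L lo (suc a) b rewrite countIn-+ L (suc lo) a b | +-suc lo a = sym (+-assoc (𝟙 (lo ∈? L)) _ _)

countIn-blocks : ∀ L c base k →
  countIn L (suc base) (c * k) ≡ ∑ k (λ i → countIn L (suc (c * toℕ i + base)) c)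
countIn-blocks L c base zero rewrite *-zeroʳ c = refl
countIn-blocks L c base (suc k) rewrite *-suc c k | countIn-+ L (suc base) c (c * k) =
  cong₂ _+_ (cong (λ z → countIn L (suc z) c) (sym (cong (_+ base) (*-zeroʳ c))))
    (trans (countIn-blocks L c (base + c) k)
      (∑-cong k (λ i → cong (λ z → countIn L (suc z) c) (ring c (toℕ i) base))))
  where ring : ∀ c i b → c * i + (b + c) ≡ c * suc i + b
        ring = solve-∀

countIn-all : ∀ L lo k → (∀ x → lo ≤ x → x < lo + k → x ∈ L) → countIn L lo k ≡ k
countIn-all L lo zero    _    = refl
countIn-all L lo (suc k) all∈ rewrite +-suc lo k =
  cong₂ _+_ (𝟙-yes (lo ∈? L) (all∈ lo ≤-refl (s≤s (m≤m+n lo k))))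
            (countIn-all L (suc lo) k (λ x lo<x x< → all∈ x (<⇒≤ lo<x) x<))

countIn-above : ∀ y lo k → y < lo → countIn (y ∷ []) lo k ≡ 0
countIn-above y lo zero    _    = refl
countIn-above y lo (suc k) y<lo =
  cong₂ _+_ (𝟙-no (lo ∈? y ∷ []) λ { (here refl) → <-irrefl refl y<lo })
            (countIn-above y (suc lo) k (m<n⇒m<1+n y<lo))

countIn-singleton : ∀ y lo k → countIn (y ∷ []) lo k ≤ 1
countIn-singleton y lo zero = z≤n
countIn-singleton y lo (suc k) with lo ∈? y ∷ []
... | yes (here refl) = ≤-reflexive (cong suc (countIn-above y (suc lo) k ≤-refl))
... | no _            = countIn-singleton y (suc lo) k

𝟙-∈-∷ : ∀ y L x → 𝟙 (x ∈? y ∷ L) ≤ 𝟙 (x ∈? y ∷ []) + 𝟙 (x ∈? L)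
𝟙-∈-∷ y L x with x ∈? y ∷ L
... | no _ = z≤n
... | yes (here refl) rewrite 𝟙-yes (x ∈? y ∷ []) (here refl) = s≤s z≤n
... | yes (there x∈L) rewrite 𝟙-yes (x ∈? L) x∈L = m≤n+m 1 _

countIn-∷ : ∀ y L lo k → countIn (y ∷ L) lo k ≤ countIn (y ∷ []) lo k + countIn L lo k
countIn-∷ y L lo zero = z≤n
countIn-∷ y L lo (suc k) = begin
  𝟙 (lo ∈? y ∷ L) + countIn (y ∷ L) (suc lo) k
    ≤⟨ +-mono-≤ (𝟙-∈-∷ y L lo) (countIn-∷ y L (suc lo) k) ⟩
  𝟙 (lo ∈? y ∷ []) + 𝟙 (lo ∈? L) + (countIn (y ∷ []) (suc lo) k + countIn L (suc lo) k)
    ≡⟨ ring (𝟙 (lo ∈? y ∷ [])) (𝟙 (lo ∈? L)) _ _ ⟩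
  𝟙 (lo ∈? y ∷ []) + countIn (y ∷ []) (suc lo) k + (𝟙 (lo ∈? L) + countIn L (suc lo) k) ∎
  where
  open ≤-Reasoning
  ring : ∀ a b c d → a + b + (c + d) ≡ a + c + (b + d)
  ring = solve-∀

countIn≤length : ∀ L lo k → countIn L lo k ≤ length L
countIn≤length []      lo zero    = z≤n
countIn≤length []      lo (suc k) = countIn≤length [] (suc lo) k
countIn≤length (y ∷ L) lo k =
  ≤-trans (countIn-∷ y L lo k) (+-mono-≤ (countIn-singleton y lo k) (countIn≤length L lo k))

Nonempty : Parsing → Set
Nonempty = All (λ ph → 1 ≤ len ph)

Triple : Set
Triple = ℕ × ℕ × ℕ

Covers : Triple → ℕ → Set
Covers (a , e , _) x = a ≤ x × x ≤ e

last-of-phrase : ∀ a l → a + suc l ∸ 1 ≡ a + l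
last-of-phrase a l = cong (_∸ 1) (+-suc a l)

spans-bounds : ∀ {P a a′ e′ b′} → Nonempty P → (a′ , e′ , b′) ∈ spans a P →
  a ≤ a′ × a′ ≤ e′ × e′ < a + sum (map len P)
spans-bounds {phrase (suc l) b ∷ P} {a} (s≤s z≤n ∷ _) (here refl) rewrite last-of-phrase a l =
  ≤-refl , m≤m+n a l , +-monoʳ-< a (s≤s (m≤m+n l (sum (map len P))))
spans-bounds {phrase (suc l) b ∷ P} {a} (s≤s z≤n ∷ ne) (there T∈)
  with spans-bounds {P} {a + suc l} ne T∈
... | a≤ , a′≤e′ , e′< =
  ≤-trans (m≤m+n a (suc l)) a≤ , a′≤e′ , ≤-trans e′< (≤-reflexive (+-assoc a (suc l) _))

phrases-ordered : ∀ {P a l a′ e′ b′} → Nonempty P → (a′ , e′ , b′) ∈ spans (a + suc l) P →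
  ¬ (a′ ≤ a + suc l ∸ 1)
phrases-ordered {a = a} {l} ne T∈ a′≤ =
  1+n≰n (subst (_≤ a + l) (+-suc a l)
    (≤-trans (proj₁ (spans-bounds ne T∈)) (≤-trans a′≤ (≤-reflexive (last-of-phrase a l)))))

spans-disjoint : ∀ {P a T T′ x} → Nonempty P → T ∈ spans a P → T′ ∈ spans a P →
  Covers T x → Covers T′ x → T ≡ T′
spans-disjoint (_ ∷ _) (here refl) (here refl) _ _ = refl
spans-disjoint {phrase (suc l) b ∷ P} {a} (s≤s z≤n ∷ ne) (here refl) (there T′∈) (_ , x≤) (a′≤x , _) =
  ⊥-elim (phrases-ordered ne T′∈ (≤-trans a′≤x x≤))
spans-disjoint {phrase (suc l) b ∷ P} {a} (s≤s z≤n ∷ ne) (there T∈) (here refl) (a′≤x , _) (_ , x≤) =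
  ⊥-elim (phrases-ordered ne T∈ (≤-trans a′≤x x≤))
spans-disjoint (_ ∷ ne) (there T∈) (there T′∈) x∈T x∈T′ = spans-disjoint ne T∈ T′∈ x∈T x∈T′

spans-cover : ∀ {P a x} → Nonempty P → a ≤ x → x < a + sum (map len P) →
  Σ Triple λ T → T ∈ spans a P × Covers T x
spans-cover {[]} {a} _ a≤x x< = ⊥-elim (<⇒≱ x< (≤-trans (≤-reflexive (+-identityʳ a)) a≤x))
spans-cover {phrase (suc l) b ∷ P} {a} {x} (s≤s z≤n ∷ ne) a≤x x< with x ≤? a + l
... | yes x≤ = _ , here refl , a≤x , subst (x ≤_) (sym (last-of-phrase a l)) x≤
... | no x≰ with spans-cover {P} {a + suc l} ne (subst (_≤ x) (sym (+-suc a l)) (≰⇒> x≰))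
                   (≤-trans x< (≤-reflexive (sym (+-assoc a (suc l) _))))
...   | T , T∈ , x∈T = T , there T∈ , x∈T

length-spans : ∀ P a → length (spans a P) ≡ length P
length-spans []       a = refl
length-spans (ph ∷ P) a = cong suc (length-spans P (a + len ph))

modP-< : ∀ {t d} → t < d → modP t d ≡ t
modP-< {t} {suc d} t<d = m<n⇒m%n≡m t<d

source-offset : ∀ {t a b} → t < a ∸ b → b + modP (t + a ∸ a) (a ∸ b) ≡ t + b
source-offset {t} {a} {b} t<d =
  trans (cong (λ u → b + modP u (a ∸ b)) (m+n∸n≡m t a)) (trans (cong (b +_) (modP-< t<d)) (+-comm b t))

hop-via-source : ∀ {P a e b x t} → (a , e , b) ∈ triples P → x ≡ t + a → x < e → t < a ∸ b →
  Hop P (t + b) 0 → Hop P x 1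
hop-via-source {P} {a} {t = t} T∈ refl x<e t<d h =
  hop-step T∈ (m≤n+m a t) x<e (subst (λ y → Hop P y 0) (sym (source-offset t<d)) h)

module LZParsing {A : Set} (s : List A) (P : Parsing) (lz : IsLZParsing s P) where

  nonempty : Nonempty P
  nonempty = proj₁ (proj₁ lz)

  ends : List ℕ
  ends = map (λ T → proj₁ (proj₂ T)) (triples P)

  End : ℕ → Set
  End x = x ∈ ends

  End? : (x : ℕ) → Dec (End x)
  End? x = x ∈? ends

  InPhrase : ℕ → Triple → Set
  InPhrase x T = T ∈ triples P × Covers T x

  phrase-at : ∀ {x} → 1 ≤ x → x ≤ length s → Σ Triple (InPhrase x)
  phrase-at 1≤x x≤ = spans-cover nonempty 1≤x (s≤s (≤-trans x≤ (≤-reflexive (sym (proj₂ (proj₁ lz))))))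

  phrase-unique : ∀ {x T T′} → InPhrase x T → InPhrase x T′ → T ≡ T′
  phrase-unique (T∈ , x∈T) (T′∈ , x∈T′) = spans-disjoint nonempty T∈ T′∈ x∈T x∈T′

  end-of : ∀ {a e b} → (a , e , b) ∈ triples P → End e
  end-of = ∈-map⁺ (λ T → proj₁ (proj₂ T))

  no-end-inside : ∀ {a e b y} → (a , e , b) ∈ triples P → a ≤ y → y < e → ¬ End y
  no-end-inside T∈ a≤y y<e y-end with ∈-map⁻ (λ T → proj₁ (proj₂ T)) y-end
  ... | (a′ , _ , b′) , T′∈ , refl
    with phrase-unique (T∈ , a≤y , <⇒≤ y<e) (T′∈ , proj₁ (proj₂ (spans-bounds nonempty T′∈)) , ≤-refl)
  ...   | refl = <-irrefl refl y<e

  nonEnd⇒< : ∀ {x a e b} → InPhrase x (a , e , b) → ¬ End x → x < e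
  nonEnd⇒< (T∈ , _ , x≤e) x-nonEnd with m≤n⇒m<n∨m≡n x≤e
  ... | inj₁ x<e  = x<e
  ... | inj₂ refl = ⊥-elim (x-nonEnd (end-of T∈))

  valid : ∀ {T} → T ∈ triples P → ValidLZPhrase s T
  valid = All.lookup (proj₂ lz)

  copy-source : ∀ {a e b x} → (a , e , b) ∈ triples P → a ≤ x → x < e →
    b + (x ∸ a) < x × at s (b + (x ∸ a)) ≡ at s x
  copy-source {a} {e} {b} {x} T∈ a≤x x<e with valid T∈
  ... | inj₁ refl = ⊥-elim (<⇒≱ x<e a≤x)
  ... | inj₂ (_ , b<a , copies) =
        subst (b + (x ∸ a) <_) (m+[n∸m]≡n a≤x) (+-monoˡ-< (x ∸ a) b<a) ,
        trans (copies (x ∸ a) (∸-monoˡ-< x<e a≤x)) (cong (at s) (m+[n∸m]≡n a≤x))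

  fresh⇒end : ∀ {x} → 1 ≤ x → x ≤ length s → (∀ y → y < x → at s y ≢ at s x) → End x
  fresh⇒end 1≤x x≤ fresh with phrase-at 1≤x x≤
  ... | (a , e , b) , T∈ , a≤x , x≤e with m≤n⇒m<n∨m≡n x≤e
  ...   | inj₂ refl = end-of T∈
  ...   | inj₁ x<e  = let y<x , same = copy-source T∈ a≤x x<e in ⊥-elim (fresh _ y<x same)

  copied-pair : ∀ {x} → 1 ≤ x → x ≤ length s → ¬ End x → ¬ End (suc x) →
    Σ ℕ λ y → y < x × at s y ≡ at s x × at s (suc y) ≡ at s (suc x)
  copied-pair {x} 1≤x x≤ x-nonEnd sx-nonEnd with phrase-at 1≤x x≤
  ... | (a , e , b) , T∈ , a≤x , x≤e =
        b + (x ∸ a) , proj₁ (copy-source T∈ a≤x x<e) , proj₂ (copy-source T∈ a≤x x<e) ,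
        trans (cong (at s) shift) (proj₂ (copy-source T∈ (m≤n⇒m≤1+n a≤x) sx<e))
    where
    x<e : x < e
    x<e = nonEnd⇒< (T∈ , a≤x , x≤e) x-nonEnd
    sx<e : suc x < e
    sx<e = nonEnd⇒< (T∈ , m≤n⇒m≤1+n a≤x , x<e) sx-nonEnd
    shift : suc (b + (x ∸ a)) ≡ b + (suc x ∸ a)
    shift = trans (sym (+-suc b (x ∸ a))) (cong (b +_) (sym (+-∸-assoc 1 a≤x)))

  countIn-ends≤size : ∀ lo k → countIn ends lo k ≤ size P
  countIn-ends≤size lo k = ≤-trans (countIn≤length ends lo k)
    (≤-reflexive (trans (length-map _ (triples P)) (length-spans P 1)))

module OneBLZParsing {A : Set} (s : List A) (P : Parsing) (blz : IsBLZ 1 s P) where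

  open LZParsing s P (proj₁ blz) public

  source-end : ∀ {x t a e b} → (a , e , b) ∈ triples P → x ≡ t + a → x < e → t < a ∸ b → x ≤ length s →
    End (t + b)
  source-end {x} {t} {a} T∈ refl x<e t<d x≤
    with proj₂ blz x (≤-trans (proj₁ (spans-bounds nonempty T∈)) (m≤n+m a t)) x≤
  ... | _ , _ , hop-last T′∈ = ⊥-elim (no-end-inside T∈ (m≤n+m a t) x<e (end-of T′∈))
  ... | _ , s≤s () , hop-step _ _ _ (hop-step _ _ _ _)
  ... | _ , _ , hop-step T′∈ a′≤x x<e′ (hop-last T″∈)
    with phrase-unique (T∈ , m≤n+m a t , <⇒≤ x<e) (T′∈ , a′≤x , <⇒≤ x<e′)
  ...   | refl = subst End (source-offset t<d) (end-of T″∈)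

  length3-phrase : ∀ {x} → End x → ¬ End (1 + x) → ¬ End (2 + x) → End (3 + x) → 3 + x ≤ length s →
    Σ ℕ λ b → (1 + x , 3 + x , b) ∈ triples P
  length3-phrase {x} x-end x₁-nonEnd x₂-nonEnd x₃-end x₃≤
    with phrase-at (s≤s z≤n) (≤-trans (n≤1+n _) (≤-trans (n≤1+n _) x₃≤))
  ... | (a , e , b) , T∈ , a≤x₁ , x₁≤e
    with nonEnd⇒< (T∈ , ≤-trans a≤x₁ (n≤1+n _) , nonEnd⇒< (T∈ , a≤x₁ , x₁≤e) x₁-nonEnd) x₂-nonEnd
  ... | x₃≤e with m≤n⇒m<n∨m≡n x₃≤e | m≤n⇒m<n∨m≡n a≤x₁
  ...   | inj₁ x₃<e | _ =
          ⊥-elim (no-end-inside T∈ (≤-trans a≤x₁ (≤-trans (n≤1+n _) (n≤1+n _))) x₃<e x₃-end)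
  ...   | inj₂ refl | inj₁ (s≤s a≤x) = ⊥-elim (no-end-inside T∈ a≤x (≤-trans (n≤1+n _) (n≤1+n _)) x-end)
  ...   | inj₂ refl | inj₂ refl = b , T∈

  length3-copy : ∀ {a b} → (a , 2 + a , b) ∈ triples P →
    b < a × at s b ≡ at s a × at s (1 + b) ≡ at s (1 + a)
  length3-copy {a} {b} T∈ with valid T∈
  ... | inj₂ (_ , b<a , copies) =
        b<a ,
        trans (cong (at s) (sym (+-identityʳ b))) (trans (copies 0 0<2) (cong (at s) (+-identityʳ a))) ,
        trans (cong (at s) (+-comm 1 b)) (trans (copies 1 1<2) (cong (at s) (+-comm a 1)))
    where
    0<2 : 0 < 2 + a ∸ a
    0<2 = subst (0 <_) (sym (m+n∸n≡m 2 a)) (s≤s z≤n)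
    1<2 : 1 < 2 + a ∸ a
    1<2 = subst (1 <_) (sym (m+n∸n≡m 2 a)) ≤-refl

  length3-sources-end : ∀ {a b} → (a , 2 + a , b) ∈ triples P → 2 + a ≤ length s →
    at s a ≢ at s (1 + a) → End b × End (1 + b)
  length3-sources-end {a} {b} T∈ a₂≤ distinct with length3-copy T∈
  ... | b<a , _ , same₁ with m≤n⇒m<n∨m≡n b<a
  ...   | inj₂ refl = ⊥-elim (distinct same₁)
  ...   | inj₁ 1+b<a =
          source-end {t = 0} T∈ refl (n≤1+n (suc a)) (m<n⇒0<n∸m b<a) (≤-trans (m≤n+m a 2) a₂≤) ,
          source-end {t = 1} T∈ refl ≤-refl (m+n≤o⇒m≤o∸n 2 1+b<a) (≤-trans (n≤1+n _) a₂≤)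

  end-pair-source : ∀ {x} → End x → ¬ End (1 + x) → ¬ End (2 + x) → End (3 + x) → 3 + x ≤ length s →
    at s (1 + x) ≢ at s (2 + x) → Σ ℕ λ b → at s b ≡ at s (1 + x) × End b × End (1 + b)
  end-pair-source x-end x₁-nonEnd x₂-nonEnd x₃-end x₃≤ distinct
    with length3-phrase x-end x₁-nonEnd x₂-nonEnd x₃-end x₃≤
  ... | b , T∈ = b , proj₁ (proj₂ (length3-copy T∈)) , length3-sources-end T∈ x₃≤ distinct

module Layout {n m : ℕ} (E : Edges n m) where

  s : List (Sym n m)
  s = s1 E

  p q : Fin m → Fin n
  p j = proj₁ (E j)
  q j = proj₂ (E j)

  blockA : Fin n → List (Sym n m)
  blockA i = vS i ∷ #p (i ↑ˡ m) ∷ []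

  blockB : Fin m → List (Sym n m)
  blockB j = eS j ∷ #p (n ↑ʳ j) ∷ []

  blockX : Fin n → List (Sym n m)
  blockX i = v′S i ∷ vS i ∷ #v i ∷ []

  oX oY N : ℕ
  oX = 2 * n + 2 * m
  oY = 3 * n + oX
  N  = 9 * m + oY

  -- P consists of the blocks vᵢ#ᵖ (A) followed by eⱼ#ᵖ (B); A i t, B j t, X i t and Y j t are
  -- the positions of the t-th symbol of the corresponding block, so Z i 0 is the position before it.
  A X : Fin n → ℕ → ℕ
  A i t = t + 2 * toℕ i
  X i t = t + (3 * toℕ i + oX)

  B Y : Fin m → ℕ → ℕ
  B j t = t + (2 * toℕ j + 2 * n)
  Y j t = t + (9 * toℕ j + oY)

  length-A : length (concatMap blockA (allFin n)) ≡ 2 * n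
  length-A = length-concatMap-const 2 blockA (λ _ → refl) id

  length-P : length (strP n m) ≡ oX
  length-P = trans (length-++ (concatMap blockA (allFin n)))
    (cong₂ _+_ length-A (length-concatMap-const 2 blockB (λ _ → refl) id))

  length-X : length (strX n m) ≡ 3 * n
  length-X = length-concatMap-const 3 blockX (λ _ → refl) id

  length-s : length s ≡ N
  length-s = begin
    length (strP n m ++ strX n m ++ strY E)              ≡⟨ length-++ (strP n m) ⟩
    length (strP n m) + length (strX n m ++ strY E)     ≡⟨ cong (length (strP n m) +_) (length-++ (strX n m)) ⟩
    length (strP n m) + (length (strX n m) + length (strY E))
      ≡⟨ cong₂ (λ a b → a + (b + length (strY E))) length-P length-X ⟩
    oX + (3 * n + length (strY E))
      ≡⟨ cong (λ c → oX + (3 * n + c)) (length-concatMap-const 9 (strYi E) (λ _ → refl) id) ⟩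
    oX + (3 * n + 9 * m)                                 ≡⟨ ring oX (3 * n) (9 * m) ⟩
    N ∎
    where
    open ≡-Reasoning
    ring : ∀ a b c → a + (b + c) ≡ c + (b + a)
    ring = solve-∀

  at-A : ∀ i {t} → 1 ≤ t → t ≤ 2 → at s (A i t) ≡ at (blockA i) t
  at-A i 1≤t t≤2 rewrite ++-assoc (concatMap blockA (allFin n)) (concatMap blockB (allFin m)) (strX n m ++ strY E) =
    at-concatMap 2 blockA (λ _ → refl) id i _ 1≤t t≤2

  at-B : ∀ j {t} → 1 ≤ t → t ≤ 2 → at s (B j t) ≡ at (blockB j) t
  at-B j {t} 1≤t t≤2 = begin
    at s (t + (2 * toℕ j + 2 * n))
      ≡⟨ cong₂ at (++-assoc (concatMap blockA (allFin n)) _ _)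
                  (trans (sym (+-assoc t _ _)) (cong (t + 2 * toℕ j +_) (sym length-A))) ⟩
    at (concatMap blockA (allFin n) ++ _) (t + 2 * toℕ j + length (concatMap blockA (allFin n)))
      ≡⟨ at-++ʳ (concatMap blockA (allFin n)) _ (≤-trans 1≤t (m≤m+n t _)) ⟩
    at (concatMap blockB (allFin m) ++ _) (t + 2 * toℕ j)
      ≡⟨ at-concatMap 2 blockB (λ _ → refl) id j _ 1≤t t≤2 ⟩
    at (blockB j) t ∎
    where open ≡-Reasoning

  at-X : ∀ i {t} → 1 ≤ t → t ≤ 3 → at s (X i t) ≡ at (blockX i) t
  at-X i {t} 1≤t t≤3 = begin
    at s (t + (3 * toℕ i + oX))
      ≡⟨ cong (at s) (trans (sym (+-assoc t _ _)) (cong (t + 3 * toℕ i +_) (sym length-P))) ⟩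
    at s (t + 3 * toℕ i + length (strP n m))
      ≡⟨ at-++ʳ (strP n m) _ (≤-trans 1≤t (m≤m+n t _)) ⟩
    at (strX n m ++ strY E) (t + 3 * toℕ i)
      ≡⟨ at-concatMap 3 blockX (λ _ → refl) id i _ 1≤t t≤3 ⟩
    at (blockX i) t ∎
    where open ≡-Reasoning

  at-Y : ∀ j {t} → 1 ≤ t → t ≤ 9 → at s (Y j t) ≡ at (strYi E j) t
  at-Y j {t} 1≤t t≤9 = begin
    at s (t + (9 * toℕ j + (3 * n + oX)))
      ≡⟨ cong (at s) (trans (ring t (9 * toℕ j) (3 * n) oX)
                            (cong₂ (λ a b → t + 9 * toℕ j + a + b) (sym length-X) (sym length-P))) ⟩
    at s (t + 9 * toℕ j + length (strX n m) + length (strP n m))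
      ≡⟨ at-++ʳ (strP n m) _ (≤-trans 1≤t (≤-trans (m≤m+n t _) (m≤m+n _ _))) ⟩
    at (strX n m ++ strY E) (t + 9 * toℕ j + length (strX n m))
      ≡⟨ at-++ʳ (strX n m) _ (≤-trans 1≤t (m≤m+n t _)) ⟩
    at (strY E) (t + 9 * toℕ j)
      ≡⟨ cong (λ l → at l (t + 9 * toℕ j)) (sym (++-identityʳ (strY E))) ⟩
    at (strY E ++ []) (t + 9 * toℕ j)
      ≡⟨ at-concatMap 9 (strYi E) (λ _ → refl) id j [] 1≤t t≤9 ⟩
    at (strYi E j) t ∎
    where
    open ≡-Reasoning
    ring : ∀ t a b c → t + (a + (b + c)) ≡ t + a + b + c
    ring = solve-∀

  data Region (x : ℕ) : Set where
    in-A : ∀ i t → 1 ≤ t → t ≤ 2 → x ≡ A i t → Region x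
    in-B : ∀ j t → 1 ≤ t → t ≤ 2 → x ≡ B j t → Region x
    in-X : ∀ i t → 1 ≤ t → t ≤ 3 → x ≡ X i t → Region x
    in-Y : ∀ j t → 1 ≤ t → t ≤ 9 → x ≡ Y j t → Region x

  region : ∀ {x} → 1 ≤ x → x ≤ N → Region x
  region {x} 1≤x x≤N with split-range oY (9 * m) x (≤-trans x≤N (≤-reflexive (+-comm (9 * m) oY)))
  ... | inj₂ (x′ , 1≤x′ , x′≤ , refl) with block-decomposition 9 m x′ 1≤x′ x′≤
  ...   | j , t , 1≤t , t≤9 , refl = in-Y j t 1≤t t≤9 (+-assoc t _ oY)
  region {x} 1≤x x≤N | inj₁ x≤oY with split-range oX (3 * n) x (≤-trans x≤oY (≤-reflexive (+-comm (3 * n) oX)))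
  ... | inj₂ (x′ , 1≤x′ , x′≤ , refl) with block-decomposition 3 n x′ 1≤x′ x′≤
  ...   | i , t , 1≤t , t≤3 , refl = in-X i t 1≤t t≤3 (+-assoc t _ oX)
  region {x} 1≤x x≤N | inj₁ _ | inj₁ x≤oX with split-range (2 * n) (2 * m) x x≤oX
  ... | inj₂ (x′ , 1≤x′ , x′≤ , refl) with block-decomposition 2 m x′ 1≤x′ x′≤
  ...   | j , t , 1≤t , t≤2 , refl = in-B j t 1≤t t≤2 (+-assoc t _ (2 * n))
  region {x} 1≤x x≤N | inj₁ _ | inj₁ _ | inj₁ x≤2n with block-decomposition 2 n x 1≤x x≤2n
  ... | i , t , 1≤t , t≤2 , refl = in-A i t 1≤t t≤2 refl

  data Occurs : Sym n m → ℕ → Set where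
    P-v   : ∀ i → Occurs (vS i) (A i 1)
    P-#v  : ∀ i → Occurs (#p (i ↑ˡ m)) (A i 2)
    P-e   : ∀ j → Occurs (eS j) (B j 1)
    P-#e  : ∀ j → Occurs (#p (n ↑ʳ j)) (B j 2)
    X-v′  : ∀ i → Occurs (v′S i) (X i 1)
    X-v   : ∀ i → Occurs (vS i) (X i 2)
    X-#   : ∀ i → Occurs (#v i) (X i 3)
    Y-v′p : ∀ j → Occurs (v′S (p j)) (Y j 1)
    Y-vp  : ∀ j → Occurs (vS (p j)) (Y j 2)
    Y-e   : ∀ j → Occurs (eS j) (Y j 3)
    Y-$   : ∀ j → Occurs ($S j) (Y j 4)
    Y-v′q : ∀ j → Occurs (v′S (q j)) (Y j 5)
    Y-vq  : ∀ j → Occurs (vS (q j)) (Y j 6)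
    Y-e′  : ∀ j → Occurs (eS j) (Y j 7)
    Y-$′  : ∀ j → Occurs ($S j) (Y j 8)
    Y-#   : ∀ j → Occurs (#e j) (Y j 9)

  occurs⇒at : ∀ {c x} → Occurs c x → at s x ≡ just c
  occurs⇒at (P-v i)   = at-A i (s≤s z≤n) (s≤s z≤n)
  occurs⇒at (P-#v i)  = at-A i (s≤s z≤n) ≤-refl
  occurs⇒at (P-e j)   = at-B j (s≤s z≤n) (s≤s z≤n)
  occurs⇒at (P-#e j)  = at-B j (s≤s z≤n) ≤-refl
  occurs⇒at (X-v′ i)  = at-X i (s≤s z≤n) (s≤s z≤n)
  occurs⇒at (X-v i)   = at-X i (s≤s z≤n) (s≤s (s≤s z≤n))
  occurs⇒at (X-# i)   = at-X i (s≤s z≤n) ≤-refl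
  occurs⇒at (Y-v′p j) = at-Y j (s≤s z≤n) (m≤m+n 1 8)
  occurs⇒at (Y-vp j)  = at-Y j (s≤s z≤n) (m≤m+n 2 7)
  occurs⇒at (Y-e j)   = at-Y j (s≤s z≤n) (m≤m+n 3 6)
  occurs⇒at (Y-$ j)   = at-Y j (s≤s z≤n) (m≤m+n 4 5)
  occurs⇒at (Y-v′q j) = at-Y j (s≤s z≤n) (m≤m+n 5 4)
  occurs⇒at (Y-vq j)  = at-Y j (s≤s z≤n) (m≤m+n 6 3)
  occurs⇒at (Y-e′ j)  = at-Y j (s≤s z≤n) (m≤m+n 7 2)
  occurs⇒at (Y-$′ j)  = at-Y j (s≤s z≤n) (m≤m+n 8 1)
  occurs⇒at (Y-# j)   = at-Y j (s≤s z≤n) ≤-refl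

  at⇒occurs : ∀ {c x} → at s x ≡ just c → Occurs c x
  at⇒occurs {c} {x} x↦c with at-bounds s x x↦c
  ... | 1≤x , x≤ with region 1≤x (≤-trans x≤ (≤-reflexive length-s))
  ...   | in-A i t 1≤t t≤2 refl = read-A t (trans (sym (at-A i 1≤t t≤2)) x↦c)
    where
    read-A : ∀ t → at (blockA i) t ≡ just c → Occurs c (A i t)
    read-A 1 refl = P-v i
    read-A 2 refl = P-#v i
  ...   | in-B j t 1≤t t≤2 refl = read-B t (trans (sym (at-B j 1≤t t≤2)) x↦c)
    where
    read-B : ∀ t → at (blockB j) t ≡ just c → Occurs c (B j t)
    read-B 1 refl = P-e j
    read-B 2 refl = P-#e j
  ...   | in-X i t 1≤t t≤3 refl = read-X t (trans (sym (at-X i 1≤t t≤3)) x↦c)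
    where
    read-X : ∀ t → at (blockX i) t ≡ just c → Occurs c (X i t)
    read-X 1 refl = X-v′ i
    read-X 2 refl = X-v i
    read-X 3 refl = X-# i
  ...   | in-Y j t 1≤t t≤9 refl = read-Y t (trans (sym (at-Y j 1≤t t≤9)) x↦c)
    where
    read-Y : ∀ t → at (strYi E j) t ≡ just c → Occurs c (Y j t)
    read-Y 1 refl = Y-v′p j
    read-Y 2 refl = Y-vp j
    read-Y 3 refl = Y-e j
    read-Y 4 refl = Y-$ j
    read-Y 5 refl = Y-v′q j
    read-Y 6 refl = Y-vq j
    read-Y 7 refl = Y-e′ j
    read-Y 8 refl = Y-$′ j
    read-Y 9 refl = Y-# j

  A≤2n : ∀ i {t} → t ≤ 2 → A i t ≤ 2 * n
  A≤2n i = block-end 2 i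

  B≤oX : ∀ j {t} → t ≤ 2 → B j t ≤ oX
  B≤oX j {t} t≤2 = begin
    t + (2 * toℕ j + 2 * n) ≡⟨ sym (+-assoc t _ _) ⟩
    t + 2 * toℕ j + 2 * n   ≤⟨ +-monoˡ-≤ (2 * n) (block-end 2 j t≤2) ⟩
    2 * m + 2 * n           ≡⟨ +-comm (2 * m) (2 * n) ⟩
    oX ∎
    where open ≤-Reasoning

  X≤oY : ∀ i {t} → t ≤ 3 → X i t ≤ oY
  X≤oY i {t} t≤3 = ≤-trans (≤-reflexive (sym (+-assoc t _ oX))) (+-monoˡ-≤ oX (block-end 3 i t≤3))

  Y≤N : ∀ j {t} → t ≤ 9 → Y j t ≤ N
  Y≤N j {t} t≤9 = ≤-trans (≤-reflexive (sym (+-assoc t _ oY))) (+-monoˡ-≤ oY (block-end 9 j t≤9))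

  2n≤oX : 2 * n ≤ oX
  2n≤oX = m≤m+n (2 * n) (2 * m)

  oX≤X : ∀ i t → oX ≤ X i t
  oX≤X i t = ≤-trans (m≤n+m oX (3 * toℕ i)) (m≤n+m _ t)

  oX≤oY : oX ≤ oY
  oX≤oY = m≤n+m oX (3 * n)

  oY≤Y : ∀ j t → oY ≤ Y j t
  oY≤Y j t = ≤-trans (m≤n+m oY (9 * toℕ j)) (m≤n+m _ t)

  P<X : ∀ {x} i t → x ≤ oX → x < X i (suc t)
  P<X i t x≤oX = s≤s (≤-trans x≤oX (oX≤X i t))

  P<Y : ∀ {x} j t → x ≤ oX → x < Y j (suc t)
  P<Y j t x≤oX = s≤s (≤-trans x≤oX (≤-trans oX≤oY (oY≤Y j t)))

  X<Y : ∀ i j {t} t′ → t ≤ 3 → X i t < Y j (suc t′)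
  X<Y i j t′ t≤3 = s≤s (≤-trans (X≤oY i t≤3) (oY≤Y j t′))

  Y-< : ∀ j t d → Y j t < Y j (suc d + t)
  Y-< j t d = +-monoˡ-< (9 * toℕ j + oY) (s≤s (m≤n+m t d))

  first : Sym n m → ℕ
  first (vS i)  = A i 1
  first (#p k)  = 2 + 2 * toℕ k
  first (eS j)  = B j 1
  first (v′S i) = X i 1
  first (#v i)  = X i 3
  first ($S j)  = Y j 4
  first (#e j)  = Y j 9

  first-#p-A : ∀ i → A i 2 ≡ first (#p (i ↑ˡ m))
  first-#p-A i = cong (λ k → 2 + 2 * k) (sym (toℕ-↑ˡ i m))

  first-#p-B : ∀ j → B j 2 ≡ first (#p (n ↑ʳ j))
  first-#p-B j = cong (2 +_) (begin
    2 * toℕ j + 2 * n     ≡⟨ +-comm (2 * toℕ j) (2 * n) ⟩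
    2 * n + 2 * toℕ j     ≡⟨ sym (*-distribˡ-+ 2 n (toℕ j)) ⟩
    2 * (n + toℕ j)       ≡⟨ cong (2 *_) (sym (toℕ-↑ʳ n j)) ⟩
    2 * toℕ (n ↑ʳ j) ∎)
    where open ≡-Reasoning

  first≤ : ∀ {c x} → Occurs c x → first c ≤ x
  first≤ (P-v i)   = ≤-refl
  first≤ (P-#v i)  = ≤-reflexive (sym (first-#p-A i))
  first≤ (P-e j)   = ≤-refl
  first≤ (P-#e j)  = ≤-reflexive (sym (first-#p-B j))
  first≤ (X-v′ i)  = ≤-refl
  first≤ (X-v i)   = ≤-trans (A≤2n i (s≤s z≤n)) (≤-trans 2n≤oX (oX≤X i 2))
  first≤ (X-# i)   = ≤-refl
  first≤ (Y-v′p j) = ≤-trans (X≤oY (p j) (s≤s z≤n)) (oY≤Y j 1)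
  first≤ (Y-vp j)  = ≤-trans (A≤2n (p j) (s≤s z≤n)) (≤-trans 2n≤oX (≤-trans oX≤oY (oY≤Y j 2)))
  first≤ (Y-e j)   = ≤-trans (B≤oX j (s≤s z≤n)) (≤-trans oX≤oY (oY≤Y j 3))
  first≤ (Y-$ j)   = ≤-refl
  first≤ (Y-v′q j) = ≤-trans (X≤oY (q j) (s≤s z≤n)) (oY≤Y j 5)
  first≤ (Y-vq j)  = ≤-trans (A≤2n (q j) (s≤s z≤n)) (≤-trans 2n≤oX (≤-trans oX≤oY (oY≤Y j 6)))
  first≤ (Y-e′ j)  = ≤-trans (B≤oX j (s≤s z≤n)) (≤-trans oX≤oY (oY≤Y j 7))
  first≤ (Y-$′ j)  = +-monoˡ-≤ _ (m≤m+n 4 4)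
  first≤ (Y-# j)   = ≤-refl

  same-symbol : ∀ {c x y} → Occurs c x → Occurs c y → at s x ≡ at s y
  same-symbol occ occ′ = trans (occurs⇒at occ) (sym (occurs⇒at occ′))

  occurs-unique : ∀ {c c′ x} → Occurs c x → at s x ≡ just c′ → c ≡ c′
  occurs-unique occ x↦ = just-injective (trans (sym (occurs⇒at occ)) x↦)

  distinct-at : ∀ {c c′ x y} → Occurs c x → Occurs c′ y → c ≢ c′ → at s x ≢ at s y
  distinct-at occ occ′ c≢c′ same = c≢c′ (occurs-unique occ (trans same (occurs⇒at occ′)))

  vS-eS-occurrence : ∀ {y v j} → Occurs (vS v) y → at s (suc y) ≡ just (eS j) →
    (y ≡ Y j 2 × v ≡ p j) ⊎ (y ≡ Y j 6 × v ≡ q j)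
  vS-eS-occurrence (P-v i)  sy↦ = case occurs-unique (P-#v i) sy↦ of λ ()
  vS-eS-occurrence (X-v i)  sy↦ = case occurs-unique (X-# i) sy↦ of λ ()
  vS-eS-occurrence (Y-vp j) sy↦ = case occurs-unique (Y-e j) sy↦ of λ { refl → inj₁ (refl , refl) }
  vS-eS-occurrence (Y-vq j) sy↦ = case occurs-unique (Y-e′ j) sy↦ of λ { refl → inj₂ (refl , refl) }

  $S-occurrence : ∀ {x j} → Occurs ($S j) x → x ≡ Y j 4 ⊎ x ≡ Y j 8
  $S-occurrence (Y-$ _)  = inj₁ refl
  $S-occurrence (Y-$′ _) = inj₂ refl

  first-occurrence : ∀ {c x} → Occurs c x → x ≡ first c → ∀ y → y < x → at s y ≢ at s x
  first-occurrence occ refl y y<x y↦ = <⇒≱ y<x (first≤ (at⇒occurs (trans y↦ (occurs⇒at occ))))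

  oY-first : 0 < m → Σ (Sym n m) λ c → Occurs c oY × oY ≡ first c
  oY-first 0<m with n ≟ 0
  ... | no n≢0 with m≤n⇒∃[o]m+o≡n (n≢0⇒n>0 n≢0)
  ...   | n′ , refl = #v i , subst (Occurs (#v i)) X₃≡oY (X-# i) , sym X₃≡oY
    where
    i = fromℕ< (n<1+n n′)
    X₃≡oY : X i 3 ≡ oY
    X₃≡oY = begin
      3 + (3 * toℕ i + oX)  ≡⟨ cong (λ k → 3 + (3 * k + oX)) (toℕ-fromℕ< (n<1+n n′)) ⟩
      3 + (3 * n′ + oX)     ≡⟨ sym (+-assoc 3 (3 * n′) oX) ⟩
      3 + 3 * n′ + oX       ≡⟨ cong (_+ oX) (sym (*-suc 3 n′)) ⟩
      oY ∎
      where open ≡-Reasoning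
  oY-first 0<m | yes refl with m≤n⇒∃[o]m+o≡n 0<m
  ... | m′ , refl = #p (0 ↑ʳ j) , subst (Occurs (#p (0 ↑ʳ j))) B₂≡oY (P-#e j) , trans (sym B₂≡oY) (first-#p-B j)
    where
    j = fromℕ< (n<1+n m′)
    ring : ∀ k → 2 + (2 * k + 2 * 0) ≡ 3 * 0 + (2 * 0 + 2 * suc k)
    ring = solve-∀
    B₂≡oY : B j 2 ≡ oY
    B₂≡oY rewrite toℕ-fromℕ< (n<1+n m′) = ring m′

  before-Y-first : ∀ j → Σ (Sym n m) λ c → Occurs c (Y j 0) × Y j 0 ≡ first c
  before-Y-first j = by-index (toℕ j) refl
    where
    by-index : ∀ k → toℕ j ≡ k → Σ (Sym n m) λ c → Occurs c (Y j 0) × Y j 0 ≡ first c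
    by-index zero toℕj≡0 =
      let c , occ , eq = oY-first (≤-trans (s≤s z≤n) (toℕ<n j)) in
      c , subst (Occurs c) (sym Y₀≡oY) occ , trans Y₀≡oY eq
      where
      Y₀≡oY : Y j 0 ≡ oY
      Y₀≡oY = cong (λ k → 9 * k + oY) toℕj≡0
    by-index (suc k) toℕj≡ = #e j′ , subst (Occurs (#e j′)) Y′₉≡Y₀ (Y-# j′) , sym Y′₉≡Y₀
      where
      k<m : k < m
      k<m = ≤-trans (n≤1+n (suc k)) (subst (_< m) toℕj≡ (toℕ<n j))
      j′ = fromℕ< k<m
      Y′₉≡Y₀ : Y j′ 9 ≡ Y j 0
      Y′₉≡Y₀ = begin
        9 + (9 * toℕ j′ + oY) ≡⟨ cong (λ z → 9 + (9 * z + oY)) (toℕ-fromℕ< k<m) ⟩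
        9 + (9 * k + oY)      ≡⟨ sym (+-assoc 9 (9 * k) oY) ⟩
        9 + 9 * k + oY        ≡⟨ cong (_+ oY) (sym (*-suc 9 k)) ⟩
        9 * suc k + oY        ≡⟨ cong (λ z → 9 * z + oY) (sym toℕj≡) ⟩
        Y j 0 ∎
        where open ≡-Reasoning

∣p∪⁅x⁆∣≤ : ∀ {n} (C : Subset n) (x : Fin n) → ∣ C ∪ ⁅ x ⁆ ∣ ≤ suc ∣ C ∣
∣p∪⁅x⁆∣≤ (true  ∷ C) zero    rewrite ∪-identityʳ C = n≤1+n _
∣p∪⁅x⁆∣≤ (false ∷ C) zero    rewrite ∪-identityʳ C = ≤-refl
∣p∪⁅x⁆∣≤ (true  ∷ C) (suc x) = s≤s (∣p∪⁅x⁆∣≤ C x)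
∣p∪⁅x⁆∣≤ (false ∷ C) (suc x) = ∣p∪⁅x⁆∣≤ C x

fromList : ∀ {n} → List (Fin n) → Subset n
fromList []      = Subset.⊥
fromList (x ∷ L) = fromList L ∪ ⁅ x ⁆

∣fromList∣≤length : ∀ {n} (L : List (Fin n)) → ∣ fromList L ∣ ≤ length L
∣fromList∣≤length {n} [] = ≤-reflexive (∣⊥∣≡0 n)
∣fromList∣≤length (x ∷ L) = ≤-trans (∣p∪⁅x⁆∣≤ (fromList L) x) (s≤s (∣fromList∣≤length L))

∈-fromList : ∀ {n} {L : List (Fin n)} {x} → x ∈ L → x ∈ₛ fromList L
∈-fromList {L = y ∷ L} (here refl) = x∈p∪q⁺ (inj₂ (x∈⁅x⁆ y))
∈-fromList {L = y ∷ L} (there x∈L) = x∈p∪q⁺ (inj₁ (∈-fromList x∈L))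

extend-to-size : ∀ {n} (C : Subset n) {k} → ∣ C ∣ ≤ k → k ≤ n →
  Σ (Subset n) λ C′ → ∣ C′ ∣ ≡ k × C ⊆ C′
extend-to-size []            {zero}  _        _       = [] , refl , λ ()
extend-to-size (true ∷ C)    {suc k} (s≤s ≤k) (s≤s k≤n) =
  let C′ , ∣C′∣≡k , C⊆C′ = extend-to-size C ≤k k≤n in
  true ∷ C′ , cong suc ∣C′∣≡k , λ { here → here ; (there x∈C) → there (C⊆C′ x∈C) }
extend-to-size {suc n} (false ∷ C) {k} ≤k k≤1+n with k ≤? n
... | yes k≤n =
  let C′ , ∣C′∣≡k , C⊆C′ = extend-to-size C ≤k k≤n in
  false ∷ C′ , ∣C′∣≡k , λ { (there x∈C) → there (C⊆C′ x∈C) }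
... | no k≰n =
  let C′ , ∣C′∣≡n , C⊆C′ = extend-to-size C (∣p∣≤n C) ≤-refl in
  true ∷ C′ , trans (cong suc ∣C′∣≡n) (≤-antisym (≰⇒> k≰n) k≤1+n) ,
  λ { (there x∈C) → there (C⊆C′ x∈C) }

dec-⊎ : {A B : Set} → Dec A → Dec B → (¬ A → ¬ B → ⊥) → A ⊎ B
dec-⊎ (yes a) _       _    = inj₁ a
dec-⊎ (no _)  (yes b) _    = inj₂ b
dec-⊎ (no ¬a) (no ¬b) none = ⊥-elim (none ¬a ¬b)

both : ℕ → ℕ → ℕ
both (suc _) (suc _) = 1
both _       _       = 0

both≤1 : ∀ a b → both a b ≤ 1
both≤1 zero    _       = z≤n
both≤1 (suc a) zero    = z≤n
both≤1 (suc a) (suc b) = ≤-refl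

1+both≤ : ∀ a b c → a ≤ 1 → 1 ≤ b + c → 1 + both a b ≤ a + (b + c)
1+both≤ zero          b       c _ 1≤b+c = 1≤b+c
1+both≤ (suc zero)    zero    c _ _     = s≤s z≤n
1+both≤ (suc zero)    (suc b) c _ _     = s≤s (s≤s z≤n)
1+both≤ (suc (suc a)) b       c (s≤s ()) _

-- iₜ indicates whether the t-th position of an edge block is a phrase end.
edge-block-≥ : ∀ i₁ i₂ i₃ i₄ i₅ i₆ i₇ i₈ i₉ → i₁ ≤ 1 → i₅ ≤ 1 → i₄ ≡ 1 → i₉ ≡ 1 →
  1 ≤ i₂ + i₃ → 1 ≤ i₆ + i₇ →
  4 + (both i₁ i₂ + both i₅ i₆) ≤ i₁ + (i₂ + (i₃ + (i₄ + (i₅ + (i₆ + (i₇ + (i₈ + (i₉ + 0))))))))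
edge-block-≥ i₁ i₂ i₃ .1 i₅ i₆ i₇ i₈ .1 i₁≤1 i₅≤1 refl refl 1≤i₂₃ 1≤i₆₇ = begin
  4 + (both i₁ i₂ + both i₅ i₆)                   ≡⟨ ring₁ (both i₁ i₂) (both i₅ i₆) ⟩
  (1 + both i₁ i₂) + (1 + both i₅ i₆) + 2
    ≤⟨ +-mono-≤ (+-mono-≤ (1+both≤ i₁ i₂ i₃ i₁≤1 1≤i₂₃) (1+both≤ i₅ i₆ i₇ i₅≤1 1≤i₆₇)) (m≤n+m 2 i₈) ⟩
  (i₁ + (i₂ + i₃)) + (i₅ + (i₆ + i₇)) + (i₈ + 2)  ≡⟨ ring₂ i₁ i₂ i₃ i₅ i₆ i₇ i₈ ⟩
  i₁ + (i₂ + (i₃ + (1 + (i₅ + (i₆ + (i₇ + (i₈ + (1 + 0)))))))) ∎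
  where
  open ≤-Reasoning
  ring₁ : ∀ a b → 4 + (a + b) ≡ 1 + a + (1 + b) + 2
  ring₁ = solve-∀
  ring₂ : ∀ i₁ i₂ i₃ i₅ i₆ i₇ i₈ →
    i₁ + (i₂ + i₃) + (i₅ + (i₆ + i₇)) + (i₈ + 2) ≡
    i₁ + (i₂ + (i₃ + (1 + (i₅ + (i₆ + (i₇ + (i₈ + (1 + 0))))))))
  ring₂ = solve-∀

edge-block-tight : ∀ i₁ i₂ i₃ i₄ i₅ i₆ i₇ i₈ i₉ → i₄ ≡ 1 → i₉ ≡ 1 → 1 ≤ i₂ + i₃ → 1 ≤ i₆ + i₇ →
  i₁ + (i₂ + (i₃ + (i₄ + (i₅ + (i₆ + (i₇ + (i₈ + (i₉ + 0)))))))) ≤ 4 →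
  i₁ ≡ 0 × i₅ ≡ 0 × i₈ ≡ 0 × (i₃ ≡ 1 → i₂ ≡ 0) × (i₇ ≡ 1 → i₆ ≡ 0)
edge-block-tight i₁ i₂ i₃ .1 i₅ i₆ i₇ i₈ .1 refl refl 1≤i₂₃ 1≤i₆₇ Σ≤4
  with m≤n⇒∃[o]m+o≡n 1≤i₂₃ | m≤n⇒∃[o]m+o≡n 1≤i₆₇
... | a , 1+a≡i₂₃ | b , 1+b≡i₆₇ =
  m+n≡0⇒m≡0 i₁ x≡0 , m+n≡0⇒m≡0 i₅ x₅≡0 , m+n≡0⇒m≡0 i₈ x₈≡0 ,
  (λ i₃≡1 → +-cancelʳ-≡ 1 i₂ 0 (trans (cong (i₂ +_) (sym i₃≡1)) (trans (sym 1+a≡i₂₃) (cong suc a≡0)))) ,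
  (λ i₇≡1 → +-cancelʳ-≡ 1 i₆ 0 (trans (cong (i₆ +_) (sym i₇≡1)) (trans (sym 1+b≡i₆₇) (cong suc b≡0))))
  where
  x = i₁ + (i₅ + (i₈ + (a + b)))
  ring₁ : ∀ i₁ i₂ i₃ i₅ i₆ i₇ i₈ →
    i₁ + (i₂ + (i₃ + (1 + (i₅ + (i₆ + (i₇ + (i₈ + (1 + 0)))))))) ≡
    2 + (i₂ + i₃) + (i₆ + i₇) + (i₁ + (i₅ + i₈))
  ring₁ = solve-∀
  ring₂ : ∀ i₁ i₅ i₈ a b → 2 + (1 + a) + (1 + b) + (i₁ + (i₅ + i₈)) ≡ 4 + (i₁ + (i₅ + (i₈ + (a + b))))
  ring₂ = solve-∀
  4+x≤4 : 4 + x ≤ 4 + 0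
  4+x≤4 = begin
    4 + x                                          ≡⟨ sym (ring₂ i₁ i₅ i₈ a b) ⟩
    2 + (1 + a) + (1 + b) + (i₁ + (i₅ + i₈))
      ≡⟨ cong₂ (λ u v → 2 + u + v + (i₁ + (i₅ + i₈))) 1+a≡i₂₃ 1+b≡i₆₇ ⟩
    2 + (i₂ + i₃) + (i₆ + i₇) + (i₁ + (i₅ + i₈))   ≡⟨ sym (ring₁ i₁ i₂ i₃ i₅ i₆ i₇ i₈) ⟩
    _                                              ≤⟨ Σ≤4 ⟩
    4 + 0 ∎
    where open ≤-Reasoning
  x≡0 : x ≡ 0
  x≡0 = n≤0⇒n≡0 (+-cancelˡ-≤ 4 x 0 4+x≤4)
  x₅≡0 : i₅ + (i₈ + (a + b)) ≡ 0
  x₅≡0 = m+n≡0⇒n≡0 i₁ x≡0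
  x₈≡0 : i₈ + (a + b) ≡ 0
  x₈≡0 = m+n≡0⇒n≡0 i₅ x₅≡0
  a≡0 : a ≡ 0
  a≡0 = m+n≡0⇒m≡0 a (m+n≡0⇒n≡0 i₈ x₈≡0)
  b≡0 : b ≡ 0
  b≡0 = m+n≡0⇒n≡0 a (m+n≡0⇒n≡0 i₈ x₈≡0)

≤+𝟙 : ∀ {a c} → a ≤ c → a + 𝟙 (suc a ≤? c) ≤ c
≤+𝟙 {a} {c} a≤c with suc a ≤? c
... | yes 1+a≤c = subst (_≤ c) (+-comm 1 a) 1+a≤c
... | no _      = subst (_≤ c) (sym (+-identityʳ a)) a≤c

∈-replicate-1 : {A : Set} {k : ℕ} {x : A} → k ≡ 1 → x ∈ replicate k x
∈-replicate-1 refl = here refl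

∈-concatMap-allFin : {A : Set} {k : ℕ} (f : Fin k → List A) (i : Fin k) {x : A} →
  x ∈ f i → x ∈ concatMap f (allFin k)
∈-concatMap-allFin f i x∈ = ∈-concatMap⁺ f (lose (∈-allFin i) x∈)

module LowerBound {n m : ℕ} (E : Edges n m) (simple : IsSimple E) (P : Parsing) (blz : IsBLZ 1 (s1 E) P) where

  open Layout E
  open OneBLZParsing s P blz

  ≤length-s : ∀ {x} → x ≤ N → x ≤ length s
  ≤length-s x≤N = ≤-trans x≤N (≤-reflexive (sym length-s))

  fresh-end : ∀ {c x} → Occurs c x → x ≡ first c → End x
  fresh-end {x = x} occ x≡ =
    let 1≤x , x≤ = at-bounds s x (occurs⇒at occ) in fresh⇒end 1≤x x≤ (first-occurrence occ x≡)

  end-P-region : ∀ {x} → Region x → x ≤ oX → End x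
  end-P-region (in-A i 1 _ _ refl) _ = fresh-end (P-v i) refl
  end-P-region (in-A i 2 _ _ refl) _ = fresh-end (P-#v i) (first-#p-A i)
  end-P-region (in-A i (suc (suc (suc _))) _ (s≤s (s≤s ())) _)
  end-P-region (in-B j 1 _ _ refl) _ = fresh-end (P-e j) refl
  end-P-region (in-B j 2 _ _ refl) _ = fresh-end (P-#e j) (first-#p-B j)
  end-P-region (in-B j (suc (suc (suc _))) _ (s≤s (s≤s ())) _)
  end-P-region (in-X i (suc t) _ _ refl) x≤oX = ⊥-elim (<⇒≱ (s≤s (oX≤X i t)) x≤oX)
  end-P-region (in-Y j (suc t) _ _ refl) x≤oX = ⊥-elim (<⇒≱ (s≤s (≤-trans oX≤oY (oY≤Y j t))) x≤oX)

  end-P : ∀ x → 1 ≤ x → x ≤ oX → End x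
  end-P x 1≤x x≤oX = end-P-region (region 1≤x (≤-trans x≤oX (≤-trans oX≤oY (m≤n+m oY (9 * m))))) x≤oX

  end-X₁ : ∀ i → End (X i 1)
  end-X₁ i = fresh-end (X-v′ i) refl

  end-X₃ : ∀ i → End (X i 3)
  end-X₃ i = fresh-end (X-# i) refl

  end-Y₀ : ∀ j → End (Y j 0)
  end-Y₀ j = let _ , occ , eq = before-Y-first j in fresh-end occ eq

  end-Y₄ : ∀ j → End (Y j 4)
  end-Y₄ j = fresh-end (Y-$ j) refl

  end-Y₉ : ∀ j → End (Y j 9)
  end-Y₉ j = fresh-end (Y-# j) refl

  end-in-vp-e : ∀ j → End (Y j 2) ⊎ End (Y j 3)
  end-in-vp-e j = dec-⊎ (End? (Y j 2)) (End? (Y j 3)) λ ¬e₂ ¬e₃ →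
    let y , y<Y₂ , same , same′ = copied-pair (s≤s z≤n) (≤length-s (Y≤N j (m≤m+n 2 7))) ¬e₂ ¬e₃ in
    [ (λ (y≡Y₂ , _) → <-irrefl y≡Y₂ y<Y₂) ,
      (λ (y≡Y₆ , _) → <⇒≱ y<Y₂ (≤-trans (<⇒≤ (Y-< j 2 3)) (≤-reflexive (sym y≡Y₆)))) ]′
      (vS-eS-occurrence (at⇒occurs (trans same (occurs⇒at (Y-vp j)))) (trans same′ (occurs⇒at (Y-e j))))

  end-in-vq-e : ∀ j → End (Y j 6) ⊎ End (Y j 7)
  end-in-vq-e j = dec-⊎ (End? (Y j 6)) (End? (Y j 7)) λ ¬e₆ ¬e₇ →
    let y , y<Y₆ , same , same′ = copied-pair (s≤s z≤n) (≤length-s (Y≤N j (m≤m+n 6 3))) ¬e₆ ¬e₇ in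
    [ (λ (_ , q≡p) → proj₁ simple j (sym q≡p)) , (λ (y≡Y₆ , _) → <-irrefl y≡Y₆ y<Y₆) ]′
      (vS-eS-occurrence (at⇒occurs (trans same (occurs⇒at (Y-vq j)))) (trans same′ (occurs⇒at (Y-e′ j))))

  -- The only earlier occurrence of eⱼ$ⱼ starts at Y j 3, which is then the hop-0 source of Y j 7.
  e$-recopied⇒Y₃-end : ∀ j → End (Y j 6) → ¬ End (Y j 7) → ¬ End (Y j 8) → End (Y j 3)
  e$-recopied⇒Y₃-end j e₆ ¬e₇ ¬e₈ =
    let b , T∈ = length3-phrase e₆ ¬e₇ ¬e₈ (end-Y₉ j) Y₉≤
        b<Y₇ , _ , same′ = length3-copy T∈
        b-end , _ = length3-sources-end T∈ Y₉≤ (distinct-at (Y-e′ j) (Y-$′ j) λ ())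
    in [ (λ 1+b≡Y₄ → subst End (suc-injective 1+b≡Y₄) b-end) ,
         (λ 1+b≡Y₈ → ⊥-elim (<-irrefl (suc-injective 1+b≡Y₈) b<Y₇)) ]′
         ($S-occurrence (at⇒occurs (trans same′ (occurs⇒at (Y-$′ j)))))
    where
    Y₉≤ : Y j 9 ≤ length s
    Y₉≤ = ≤length-s (Y≤N j ≤-refl)

  ind : ℕ → ℕ
  ind x = 𝟙 (End? x)

  one-of : ∀ {x y} → End x ⊎ End y → 1 ≤ ind x + ind y
  one-of {x} {y} (inj₁ e) = ≤-trans (≤-reflexive (sym (𝟙-yes (End? x) e))) (m≤m+n _ _)
  one-of {x} {y} (inj₂ e) = ≤-trans (≤-reflexive (sym (𝟙-yes (End? y) e))) (m≤n+m _ _)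

  ends-in-X : Fin n → ℕ
  ends-in-X i = countIn ends (X i 1) 3

  ends-in-Y : Fin m → ℕ
  ends-in-Y j = countIn ends (Y j 1) 9

  split-p split-q excess surplus : Fin m → ℕ
  split-p j = both (ind (Y j 1)) (ind (Y j 2))
  split-q j = both (ind (Y j 5)) (ind (Y j 6))
  excess j  = 𝟙 (5 + (split-p j + split-q j) ≤? ends-in-Y j)
  surplus j = split-p j + (split-q j + excess j)

  X-block-count : ∀ i → 2 + ind (X i 2) ≤ ends-in-X i
  X-block-count i = ≤-reflexive (sym (begin
    ind (X i 1) + (ind (X i 2) + (ind (X i 3) + 0))
      ≡⟨ cong₂ (λ a b → a + (ind (X i 2) + (b + 0)))
               (𝟙-yes (End? (X i 1)) (end-X₁ i)) (𝟙-yes (End? (X i 3)) (end-X₃ i)) ⟩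
    1 + (ind (X i 2) + 1)
      ≡⟨ cong suc (+-comm (ind (X i 2)) 1) ⟩
    2 + ind (X i 2) ∎))
    where open ≡-Reasoning

  Y-block-≥ : ∀ j → 4 + (split-p j + split-q j) ≤ ends-in-Y j
  Y-block-≥ j = edge-block-≥ (ind (Y j 1)) (ind (Y j 2)) (ind (Y j 3)) (ind (Y j 4)) (ind (Y j 5))
    (ind (Y j 6)) (ind (Y j 7)) (ind (Y j 8)) (ind (Y j 9)) (𝟙≤1 (End? (Y j 1))) (𝟙≤1 (End? (Y j 5)))
    (𝟙-yes (End? (Y j 4)) (end-Y₄ j)) (𝟙-yes (End? (Y j 9)) (end-Y₉ j))
    (one-of (end-in-vp-e j)) (one-of (end-in-vq-e j))

  Y-block-count : ∀ j → 4 + surplus j ≤ ends-in-Y j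
  Y-block-count j = subst (_≤ ends-in-Y j) reassoc (≤+𝟙 (Y-block-≥ j))
    where
    reassoc : 4 + (split-p j + split-q j) + excess j ≡ 4 + surplus j
    reassoc = trans (+-assoc 4 _ (excess j)) (cong (4 +_) (+-assoc (split-p j) (split-q j) (excess j)))

  cover-X : Fin n → List (Fin n)
  cover-X i = replicate (ind (X i 2)) i

  cover-Y : Fin m → List (Fin n)
  cover-Y j = replicate (split-p j) (p j) ++ replicate (split-q j) (q j) ++ replicate (excess j) (p j)

  cover : List (Fin n)
  cover = concatMap cover-X (allFin n) ++ concatMap cover-Y (allFin m)

  length-cover : length cover ≡ ∑ n (λ i → ind (X i 2)) + ∑ m surplus
  length-cover = trans (length-++ (concatMap cover-X (allFin n))) (cong₂ _+_
    (trans (length-concatMap cover-X id) (∑-cong n (λ i → length-replicate (ind (X i 2)))))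
    (trans (length-concatMap cover-Y id) (∑-cong m length-cover-Y)))
    where
    length-cover-Y : ∀ j → length (cover-Y j) ≡ surplus j
    length-cover-Y j = trans (length-++ (replicate (split-p j) (p j)))
      (cong₂ _+_ (length-replicate (split-p j))
        (trans (length-++ (replicate (split-q j) (q j)))
          (cong₂ _+_ (length-replicate (split-q j)) (length-replicate (excess j)))))

  ends-count : countIn ends 1 N ≡ oX + ∑ n ends-in-X + ∑ m ends-in-Y
  ends-count = begin
    countIn ends 1 N
      ≡⟨ cong (countIn ends 1) (trans (+-comm (9 * m) oY) (cong (_+ 9 * m) (+-comm (3 * n) oX))) ⟩
    countIn ends 1 (oX + 3 * n + 9 * m)
      ≡⟨ countIn-+ ends 1 (oX + 3 * n) (9 * m) ⟩
    countIn ends 1 (oX + 3 * n) + countIn ends (suc (oX + 3 * n)) (9 * m)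
      ≡⟨ cong₂ _+_ (countIn-+ ends 1 oX (3 * n))
                   (cong (λ b → countIn ends (suc b) (9 * m)) (+-comm oX (3 * n))) ⟩
    countIn ends 1 oX + countIn ends (suc oX) (3 * n) + countIn ends (suc oY) (9 * m)
      ≡⟨ cong₂ _+_ (cong₂ _+_ (countIn-all ends 1 oX (λ x 1≤x x< → end-P x 1≤x (s≤s⁻¹ x<)))
                              (countIn-blocks ends 3 oX n))
                   (countIn-blocks ends 9 oY m) ⟩
    oX + ∑ n ends-in-X + ∑ m ends-in-Y ∎
    where open ≡-Reasoning

  cover-size : 4 * n + 6 * m + length cover ≤ size P
  cover-size = begin
    4 * n + 6 * m + length cover
      ≡⟨ cong (4 * n + 6 * m +_) length-cover ⟩
    4 * n + 6 * m + (∑ n (λ i → ind (X i 2)) + ∑ m surplus)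
      ≡⟨ ring n m (∑ n (λ i → ind (X i 2))) (∑ m surplus) ⟩
    oX + (2 * n + ∑ n (λ i → ind (X i 2))) + (4 * m + ∑ m surplus)
      ≡⟨ sym (cong₂ (λ a b → oX + a + b) (∑-const+ n 2 (λ i → ind (X i 2))) (∑-const+ m 4 surplus)) ⟩
    oX + ∑ n (λ i → 2 + ind (X i 2)) + ∑ m (λ j → 4 + surplus j)
      ≤⟨ +-mono-≤ (+-monoʳ-≤ oX (∑-mono n X-block-count)) (∑-mono m Y-block-count) ⟩
    oX + ∑ n ends-in-X + ∑ m ends-in-Y
      ≡⟨ sym ends-count ⟩
    countIn ends 1 N
      ≤⟨ countIn-ends≤size 1 N ⟩
    size P ∎
    where
    open ≤-Reasoning
    ring : ∀ n m a b → 4 * n + 6 * m + (a + b) ≡ 2 * n + 2 * m + (2 * n + a) + (4 * m + b)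
    ring = solve-∀

  EndPair : Fin n → Set
  EndPair v = Σ ℕ λ b → at s b ≡ just (v′S v) × End b × End (suc b)

  in-cover-Y : ∀ j {v} → v ∈ cover-Y j → v ∈ cover
  in-cover-Y j v∈ = ∈-++⁺ʳ (concatMap cover-X (allFin n)) (∈-concatMap-allFin cover-Y j v∈)

  pair-in-cover : ∀ {v b} → Occurs (v′S v) b → End b → End (suc b) → v ∈ cover
  pair-in-cover (X-v′ i)  _ e₂ = ∈-++⁺ˡ (∈-concatMap-allFin cover-X i (∈-replicate-1 (𝟙-yes (End? (X i 2)) e₂)))
  pair-in-cover (Y-v′p j) e₁ e₂ =
    in-cover-Y j (∈-++⁺ˡ (∈-replicate-1 (cong₂ both (𝟙-yes (End? (Y j 1)) e₁) (𝟙-yes (End? (Y j 2)) e₂))))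
  pair-in-cover (Y-v′q j) e₅ e₆ = in-cover-Y j (∈-++⁺ʳ (replicate (split-p j) (p j))
    (∈-++⁺ˡ (∈-replicate-1 (cong₂ both (𝟙-yes (End? (Y j 5)) e₅) (𝟙-yes (End? (Y j 6)) e₆)))))

  EndPair⇒∈cover : ∀ {v} → EndPair v → v ∈ cover
  EndPair⇒∈cover (b , b↦ , b-end , sb-end) = pair-in-cover (at⇒occurs b↦) b-end sb-end

  isolated-copy⇒EndPair : ∀ {v x} → Occurs (v′S v) (1 + x) → Occurs (vS v) (2 + x) →
    End x → ¬ End (1 + x) → ¬ End (2 + x) → End (3 + x) → 3 + x ≤ N → EndPair v
  isolated-copy⇒EndPair occ′ occ e₀ ¬e₁ ¬e₂ e₃ x₃≤N =
    let b , same , b-end , sb-end = end-pair-source e₀ ¬e₁ ¬e₂ e₃ (≤length-s x₃≤N) (distinct-at occ′ occ λ ())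
    in b , trans same (occurs⇒at occ′) , b-end , sb-end

  tight-edge : ∀ j → split-p j ≡ 0 → split-q j ≡ 0 → excess j ≡ 0 → EndPair (p j) ⊎ EndPair (q j)
  tight-edge j sp≡0 sq≡0 ex≡0 = by-ends
    (edge-block-tight (ind (Y j 1)) (ind (Y j 2)) (ind (Y j 3)) (ind (Y j 4)) (ind (Y j 5))
       (ind (Y j 6)) (ind (Y j 7)) (ind (Y j 8)) (ind (Y j 9))
       (𝟙-yes (End? (Y j 4)) (end-Y₄ j)) (𝟙-yes (End? (Y j 9)) (end-Y₉ j))
       (one-of (end-in-vp-e j)) (one-of (end-in-vq-e j)) count≤4)
    (End? (Y j 3)) (End? (Y j 7))
    where
    count≤4 : ends-in-Y j ≤ 4
    count≤4 = s≤s⁻¹ (subst (ends-in-Y j <_) (cong (λ k → 5 + k) (cong₂ _+_ sp≡0 sq≡0))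
                (≰⇒> (𝟙≡0⇒ (5 + (split-p j + split-q j) ≤? ends-in-Y j) ex≡0)))
    ¬end : ∀ x → ind x ≡ 0 → ¬ End x
    ¬end x = 𝟙≡0⇒ (End? x)
    by-ends : ind (Y j 1) ≡ 0 × ind (Y j 5) ≡ 0 × ind (Y j 8) ≡ 0 ×
              (ind (Y j 3) ≡ 1 → ind (Y j 2) ≡ 0) × (ind (Y j 7) ≡ 1 → ind (Y j 6) ≡ 0) →
              Dec (End (Y j 3)) → Dec (End (Y j 7)) → EndPair (p j) ⊎ EndPair (q j)
    by-ends (i₁≡0 , _ , _ , i₃⇒i₂ , _) (yes e₃) _ =
      inj₁ (isolated-copy⇒EndPair (Y-v′p j) (Y-vp j) (end-Y₀ j) (¬end _ i₁≡0)
              (¬end _ (i₃⇒i₂ (𝟙-yes (End? (Y j 3)) e₃))) e₃ (Y≤N j (m≤m+n 3 6)))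
    by-ends (_ , i₅≡0 , _ , _ , i₇⇒i₆) (no _) (yes e₇) =
      inj₂ (isolated-copy⇒EndPair (Y-v′q j) (Y-vq j) (end-Y₄ j) (¬end _ i₅≡0)
              (¬end _ (i₇⇒i₆ (𝟙-yes (End? (Y j 7)) e₇))) e₇ (Y≤N j (m≤m+n 7 2)))
    by-ends (_ , _ , i₈≡0 , _ , _) (no ¬e₃) (no ¬e₇) =
      [ (λ e₆ → ⊥-elim (¬e₃ (e$-recopied⇒Y₃-end j e₆ ¬e₇ (¬end _ i₈≡0)))) ,
        (λ e₇ → ⊥-elim (¬e₇ e₇)) ]′ (end-in-vq-e j)

  covered : ∀ j → p j ∈ cover ⊎ q j ∈ cover
  covered j = by-indicators (n≤1⇒n≡0∨n≡1 (both≤1 (ind (Y j 1)) (ind (Y j 2))))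
                            (n≤1⇒n≡0∨n≡1 (both≤1 (ind (Y j 5)) (ind (Y j 6))))
                            (n≤1⇒n≡0∨n≡1 (𝟙≤1 (5 + (split-p j + split-q j) ≤? ends-in-Y j)))
    where
    by-indicators : split-p j ≡ 0 ⊎ split-p j ≡ 1 → split-q j ≡ 0 ⊎ split-q j ≡ 1 →
      excess j ≡ 0 ⊎ excess j ≡ 1 → p j ∈ cover ⊎ q j ∈ cover
    by-indicators (inj₂ sp≡1) _ _ = inj₁ (in-cover-Y j (∈-++⁺ˡ (∈-replicate-1 sp≡1)))
    by-indicators (inj₁ _) (inj₂ sq≡1) _ =
      inj₂ (in-cover-Y j (∈-++⁺ʳ (replicate (split-p j) (p j)) (∈-++⁺ˡ (∈-replicate-1 sq≡1))))
    by-indicators (inj₁ _) (inj₁ _) (inj₂ ex≡1) = inj₁ (in-cover-Y j (∈-++⁺ʳ (replicate (split-p j) (p j))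
      (∈-++⁺ʳ (replicate (split-q j) (q j)) (∈-replicate-1 ex≡1))))
    by-indicators (inj₁ sp≡0) (inj₁ sq≡0) (inj₁ ex≡0) =
      Sum.map EndPair⇒∈cover EndPair⇒∈cover (tight-edge j sp≡0 sq≡0 ex≡0)

  vertex-cover : ∀ {k} → size P ≡ 4 * n + 6 * m + k → k ≤ n → HasVertexCoverOfSize E k
  vertex-cover {k} size≡ k≤n =
    let C , ∣C∣≡k , cover⊆C =
          extend-to-size (fromList cover) (≤-trans (∣fromList∣≤length cover) length-cover≤k) k≤n in
    C , ∣C∣≡k , λ j → Sum.map (cover⊆C ∘ ∈-fromList) (cover⊆C ∘ ∈-fromList) (covered j)
    where
    length-cover≤k : length cover ≤ k
    length-cover≤k = +-cancelˡ-≤ (4 * n + 6 * m) (length cover) k (≤-trans cover-size (≤-reflexive size≡))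

total-length : Parsing → ℕ
total-length P = sum (map len P)

total-length-++ : ∀ xs ys → total-length (xs ++ ys) ≡ total-length xs + total-length ys
total-length-++ xs ys = trans (cong sum (map-++ len xs ys)) (sum-++ (map len xs) (map len ys))

-- The triples of a parsing, written so that for phrases of literal length the positions
-- compute definitionally; it agrees with spans on nonempty phrases.
spans′ : ℕ → Parsing → List Triple
spans′ a []       = []
spans′ a (ph ∷ P) = (a , pred (len ph) + a , src ph) ∷ spans′ (len ph + a) P

spans≡spans′ : ∀ {P} a → Nonempty P → spans a P ≡ spans′ a P
spans≡spans′ {[]} a [] = refl
spans≡spans′ {phrase (suc l) b ∷ P} a (s≤s z≤n ∷ ne) =
  cong₂ _∷_ (cong (λ e → (a , e , b)) (trans (last-of-phrase a l) (+-comm a l)))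
            (trans (cong (λ a′ → spans a′ P) (+-comm a (suc l))) (spans≡spans′ (suc l + a) ne))

spans′-++ : ∀ a xs ys → spans′ a (xs ++ ys) ≡ spans′ a xs ++ spans′ (total-length xs + a) ys
spans′-++ a []       ys = refl
spans′-++ a (ph ∷ xs) ys = cong (_ ∷_) (trans (spans′-++ (len ph + a) xs ys)
  (cong (λ a′ → spans′ (len ph + a) xs ++ spans′ a′ ys) (ring (total-length xs) (len ph) a)))
  where ring : ∀ t l a → t + (l + a) ≡ l + t + a
        ring = solve-∀

spans′-concatMap : {B : Set} (c : ℕ) (f : B → Parsing) → (∀ x → total-length (f x) ≡ c) →
  ∀ {k} (g : Fin k → B) base →
  spans′ (suc base) (concatMap f (tabulate g)) ≡ concat (tabulate (λ i → spans′ (suc (c * toℕ i + base)) (f (g i))))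
spans′-concatMap c f total {zero}  g base = refl
spans′-concatMap c f total {suc k} g base = begin
  spans′ (suc base) (f (g zero) ++ concatMap f (tabulate (g ∘ suc)))
    ≡⟨ spans′-++ (suc base) (f (g zero)) _ ⟩
  spans′ (suc base) (f (g zero)) ++ spans′ (total-length (f (g zero)) + suc base) (concatMap f (tabulate (g ∘ suc)))
    ≡⟨ cong₂ _++_ (cong (λ b → spans′ (suc b) (f (g zero))) (cong (_+ base) (sym (*-zeroʳ c))))
                  (trans (cong (λ a → spans′ a (concatMap f (tabulate (g ∘ suc))))
                               (trans (cong (_+ suc base) (total (g zero))) (+-suc c base)))
                         (spans′-concatMap c f total (g ∘ suc) (c + base))) ⟩
  spans′ (suc (c * 0 + base)) (f (g zero)) ++
    concat (tabulate (λ i → spans′ (suc (c * toℕ i + (c + base))) (f (g (suc i)))))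
    ≡⟨ cong (λ xs → spans′ (suc (c * 0 + base)) (f (g zero)) ++ concat xs)
            (tabulate-cong (λ i → cong (λ b → spans′ (suc b) (f (g (suc i)))) (ring c (toℕ i) base))) ⟩
  concat (tabulate (λ i → spans′ (suc (c * toℕ i + base)) (f (g i)))) ∎
  where
  open ≡-Reasoning
  ring : ∀ c i b → c * i + (c + b) ≡ c * suc i + b
  ring = solve-∀

single : Phrase
single = phrase 1 0

single∈spans′ : ∀ k {a x} → a ≤ x → x < k + a → (x , x , 0) ∈ spans′ a (replicate k single)
single∈spans′ zero    a≤x x<a = ⊥-elim (<⇒≱ x<a a≤x)
single∈spans′ (suc k) {a} {x} a≤x x< with m≤n⇒m<n∨m≡n a≤x
... | inj₂ refl = here refl
... | inj₁ a<x  = there (single∈spans′ k a<x (subst (x <_) (sym (+-suc k a)) x<))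

singles-valid : {A : Set} (s : List A) → ∀ k a → All (ValidLZPhrase s) (spans′ a (replicate k single))
singles-valid s zero    a = []
singles-valid s (suc k) a = inj₁ refl ∷ singles-valid s k (suc a)

singles-nonempty : ∀ k → Nonempty (replicate k single)
singles-nonempty zero    = []
singles-nonempty (suc k) = s≤s z≤n ∷ singles-nonempty k

total-length-singles : ∀ k → total-length (replicate k single) ≡ k
total-length-singles zero    = refl
total-length-singles (suc k) = cong suc (total-length-singles k)

copy₁-valid : {A : Set} (s : List A) {a b : ℕ} → 1 ≤ b → b < a → at s b ≡ at s a →
  ValidLZPhrase s (a , suc a , b)
copy₁-valid s {a} {b} 1≤b b<a same = inj₂ (1≤b , b<a , copies)
  where
  copies : ∀ t → t < suc a ∸ a → at s (b + t) ≡ at s (a + t)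
  copies t t<1 with subst (t <_) (m+n∸n≡m 1 a) t<1
  ... | s≤s z≤n = trans (cong (at s) (+-identityʳ b)) (trans same (cong (at s) (sym (+-identityʳ a))))

copy₂-valid : {A : Set} (s : List A) {a b : ℕ} → 1 ≤ b → b < a → at s b ≡ at s a →
  at s (suc b) ≡ at s (suc a) → ValidLZPhrase s (a , suc (suc a) , b)
copy₂-valid s {a} {b} 1≤b b<a same same′ = inj₂ (1≤b , b<a , copies)
  where
  copies : ∀ t → t < suc (suc a) ∸ a → at s (b + t) ≡ at s (a + t)
  copies t t<2 with subst (t <_) (m+n∸n≡m 2 a) t<2
  ... | s≤s z≤n       = trans (cong (at s) (+-identityʳ b)) (trans same (cong (at s) (sym (+-identityʳ a))))
  ... | s≤s (s≤s z≤n) = trans (cong (at s) (+-comm b 1)) (trans same′ (cong (at s) (+-comm 1 a)))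

∑-lookup : ∀ {k} (D : Subset k) → ∑ k (λ i → 𝟙 (lookup D i Bool.≟ true)) ≡ ∣ D ∣
∑-lookup []          = refl
∑-lookup (true ∷ D)  = cong suc (∑-lookup D)
∑-lookup (false ∷ D) = ∑-lookup D

module Construction {n m : ℕ} (E : Edges n m) (C : Subset n) (isCover : IsVertexCover E C) where

  open Layout E

  inC : Fin n → Bool
  inC = lookup C

  X-phrases : Bool → Fin n → Parsing
  X-phrases true  i = single ∷ single ∷ single ∷ []
  X-phrases false i = single ∷ phrase 2 (A i 1) ∷ []

  Y-phrases : Bool → Fin m → Parsing
  Y-phrases true  j = phrase 3 (X (p j) 1) ∷ single ∷ phrase 2 (X (q j) 1) ∷ phrase 3 (Y j 3) ∷ []
  Y-phrases false j = phrase 2 (X (p j) 1) ∷ phrase 2 (B j 1) ∷ phrase 3 (X (q j) 1) ∷ phrase 2 (Y j 4) ∷ []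

  X-block : Fin n → Parsing
  X-block i = X-phrases (inC i) i

  Y-block : Fin m → Parsing
  Y-block j = Y-phrases (inC (p j)) j

  P-part X-part Y-part parsing : Parsing
  P-part  = replicate oX single
  X-part  = concatMap X-block (allFin n)
  Y-part  = concatMap Y-block (allFin m)
  parsing = P-part ++ X-part ++ Y-part

  X-nonempty : ∀ b i → Nonempty (X-phrases b i)
  X-nonempty true  i = s≤s z≤n ∷ s≤s z≤n ∷ s≤s z≤n ∷ []
  X-nonempty false i = s≤s z≤n ∷ s≤s z≤n ∷ []

  Y-nonempty : ∀ b j → Nonempty (Y-phrases b j)
  Y-nonempty true  j = s≤s z≤n ∷ s≤s z≤n ∷ s≤s z≤n ∷ s≤s z≤n ∷ []
  Y-nonempty false j = s≤s z≤n ∷ s≤s z≤n ∷ s≤s z≤n ∷ s≤s z≤n ∷ []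

  X-total : ∀ b i → total-length (X-phrases b i) ≡ 3
  X-total true  i = refl
  X-total false i = refl

  Y-total : ∀ b j → total-length (Y-phrases b j) ≡ 9
  Y-total true  j = refl
  Y-total false j = refl

  nonempty : Nonempty parsing
  nonempty = ++⁺ (singles-nonempty oX) (++⁺
    (concat⁺ (map⁺ (tabulate⁺ (λ i → X-nonempty (inC i) i))))
    (concat⁺ (map⁺ (tabulate⁺ (λ j → Y-nonempty (inC (p j)) j)))))

  total-X : total-length X-part ≡ 3 * n
  total-X = additive-concatMap-const total-length refl total-length-++ 3 X-block (λ i → X-total (inC i) i) id

  total-Y : total-length Y-part ≡ 9 * m
  total-Y = additive-concatMap-const total-length refl total-length-++ 9 Y-block (λ j → Y-total (inC (p j)) j) id

  total : total-length parsing ≡ length s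
  total = begin
    total-length parsing
      ≡⟨ total-length-++ P-part _ ⟩
    total-length P-part + total-length (X-part ++ Y-part)
      ≡⟨ cong₂ _+_ (total-length-singles oX) (total-length-++ X-part _) ⟩
    oX + (total-length X-part + total-length Y-part)
      ≡⟨ cong (oX +_) (cong₂ _+_ total-X total-Y) ⟩
    oX + (3 * n + 9 * m)
      ≡⟨ ring oX (3 * n) (9 * m) ⟩
    N
      ≡⟨ sym length-s ⟩
    length s ∎
    where
    open ≡-Reasoning
    ring : ∀ a b c → a + (b + c) ≡ c + (b + a)
    ring = solve-∀

  X-triples : Fin n → List Triple
  X-triples i = spans′ (X i 1) (X-block i)

  Y-triples : Fin m → List Triple
  Y-triples j = spans′ (Y j 1) (Y-block j)

  triples-parsing : triples parsing ≡
    spans′ 1 P-part ++ concat (tabulate X-triples) ++ concat (tabulate Y-triples)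
  triples-parsing = begin
    spans 1 parsing
      ≡⟨ spans≡spans′ 1 nonempty ⟩
    spans′ 1 parsing
      ≡⟨ spans′-++ 1 P-part _ ⟩
    spans′ 1 P-part ++ spans′ (total-length P-part + 1) (X-part ++ Y-part)
      ≡⟨ cong (λ a → spans′ 1 P-part ++ spans′ a (X-part ++ Y-part))
              (trans (cong (_+ 1) (total-length-singles oX)) (+-comm oX 1)) ⟩
    spans′ 1 P-part ++ spans′ (suc oX) (X-part ++ Y-part)
      ≡⟨ cong (spans′ 1 P-part ++_) (spans′-++ (suc oX) X-part _) ⟩
    spans′ 1 P-part ++ spans′ (suc oX) X-part ++
      spans′ (total-length X-part + suc oX) Y-part
      ≡⟨ cong (λ a → spans′ 1 P-part ++ spans′ (suc oX) X-part ++ spans′ a Y-part)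
              (trans (cong (_+ suc oX) total-X) (+-suc (3 * n) oX)) ⟩
    spans′ 1 P-part ++ spans′ (suc oX) X-part ++ spans′ (suc oY) Y-part
      ≡⟨ cong₂ (λ xs ys → spans′ 1 P-part ++ xs ++ ys)
               (spans′-concatMap 3 X-block (λ i → X-total (inC i) i) id oX)
               (spans′-concatMap 9 Y-block (λ j → Y-total (inC (p j)) j) id oY) ⟩
    spans′ 1 P-part ++ concat (tabulate X-triples) ++ concat (tabulate Y-triples) ∎
    where open ≡-Reasoning

  X-valid : ∀ b i → All (ValidLZPhrase s) (spans′ (X i 1) (X-phrases b i))
  X-valid true  i = inj₁ refl ∷ inj₁ refl ∷ inj₁ refl ∷ []
  X-valid false i = inj₁ refl ∷
    copy₁-valid s (s≤s z≤n) (P<X i 1 (≤-trans (A≤2n i (s≤s z≤n)) 2n≤oX)) (same-symbol (P-v i) (X-v i)) ∷ []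

  Y-valid : ∀ b j → All (ValidLZPhrase s) (spans′ (Y j 1) (Y-phrases b j))
  Y-valid true j =
    copy₂-valid s (s≤s z≤n) (X<Y (p j) j 0 (s≤s z≤n))
      (same-symbol (X-v′ (p j)) (Y-v′p j)) (same-symbol (X-v (p j)) (Y-vp j)) ∷
    inj₁ refl ∷
    copy₁-valid s (s≤s z≤n) (X<Y (q j) j 4 (s≤s z≤n)) (same-symbol (X-v′ (q j)) (Y-v′q j)) ∷
    copy₂-valid s (s≤s z≤n) (Y-< j 3 3)
      (same-symbol (Y-e j) (Y-e′ j)) (same-symbol (Y-$ j) (Y-$′ j)) ∷ []
  Y-valid false j =
    copy₁-valid s (s≤s z≤n) (X<Y (p j) j 0 (s≤s z≤n)) (same-symbol (X-v′ (p j)) (Y-v′p j)) ∷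
    copy₁-valid s (s≤s z≤n) (P<Y j 2 (B≤oX j (s≤s z≤n))) (same-symbol (P-e j) (Y-e j)) ∷
    copy₂-valid s (s≤s z≤n) (X<Y (q j) j 4 (s≤s z≤n))
      (same-symbol (X-v′ (q j)) (Y-v′q j)) (same-symbol (X-v (q j)) (Y-vq j)) ∷
    copy₁-valid s (s≤s z≤n) (Y-< j 4 3) (same-symbol (Y-$ j) (Y-$′ j)) ∷ []

  valid : All (ValidLZPhrase s) (triples parsing)
  valid = subst (All (ValidLZPhrase s)) (sym triples-parsing) (++⁺ (singles-valid s oX 1) (++⁺
    (concat⁺ (tabulate⁺ (λ i → X-valid (inC i) i)))
    (concat⁺ (tabulate⁺ (λ j → Y-valid (inC (p j)) j)))))

  single∈ : ∀ {x} → 1 ≤ x → x ≤ oX → (x , x , 0) ∈ triples parsing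
  single∈ 1≤x x≤oX = subst (_ ∈_) (sym triples-parsing)
    (∈-++⁺ˡ (single∈spans′ oX 1≤x (≤-trans (s≤s x≤oX) (≤-reflexive (+-comm 1 oX)))))

  X∈ : ∀ b i {T} → inC i ≡ b → T ∈ spans′ (X i 1) (X-phrases b i) → T ∈ triples parsing
  X∈ b i refl T∈ = subst (_ ∈_) (sym triples-parsing)
    (∈-++⁺ʳ (spans′ 1 P-part) (∈-++⁺ˡ (∈-concat⁺′ T∈ (∈-tabulate⁺ i))))

  Y∈ : ∀ b j {T} → inC (p j) ≡ b → T ∈ spans′ (Y j 1) (Y-phrases b j) → T ∈ triples parsing
  Y∈ b j refl T∈ = subst (_ ∈_) (sym triples-parsing)
    (∈-++⁺ʳ (spans′ 1 P-part) (∈-++⁺ʳ (concat (tabulate X-triples)) (∈-concat⁺′ T∈ (∈-tabulate⁺ j))))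

  Hop≤1 : ℕ → Set
  Hop≤1 x = Σ ℕ λ h → h ≤ 1 × Hop parsing x h

  hop₀ : ∀ {x} → Hop parsing x 0 → Hop≤1 x
  hop₀ h = 0 , z≤n , h

  via : ∀ {a e b x} t → (a , e , b) ∈ triples parsing → x ≡ t + a → x < e → t + b < a →
    Hop parsing (t + b) 0 → Hop≤1 x
  via t T∈ x≡ x<e t+b<a h = 1 , ≤-refl , hop-via-source T∈ x≡ x<e (m+n≤o⇒m≤o∸n (suc t) t+b<a) h

  hop-P : ∀ {x} → 1 ≤ x → x ≤ oX → Hop parsing x 0
  hop-P 1≤x x≤oX = hop-last (single∈ 1≤x x≤oX)

  hop-X₁ : ∀ i → Hop parsing (X i 1) 0
  hop-X₁ i with inC i in eq
  ... | true  = hop-last (X∈ true i eq (here refl))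
  ... | false = hop-last (X∈ false i eq (here refl))

  hop-X₂ : ∀ i → inC i ≡ true → Hop parsing (X i 2) 0
  hop-X₂ i eq = hop-last (X∈ true i eq (there (here refl)))

  hop-X : ∀ i b → inC i ≡ b → ∀ t → 1 ≤ t → t ≤ 3 → Hop≤1 (X i t)
  hop-X i true  eq 1 _ _ = hop₀ (hop-last (X∈ true i eq (here refl)))
  hop-X i true  eq 2 _ _ = hop₀ (hop-last (X∈ true i eq (there (here refl))))
  hop-X i true  eq 3 _ _ = hop₀ (hop-last (X∈ true i eq (there (there (here refl)))))
  hop-X i false eq 1 _ _ = hop₀ (hop-last (X∈ false i eq (here refl)))
  hop-X i false eq 2 _ _ = via 0 (X∈ false i eq (there (here refl))) refl ≤-refl
    (P<X i 1 (≤-trans (A≤2n i (s≤s z≤n)) 2n≤oX)) (hop-P (s≤s z≤n) (≤-trans (A≤2n i (s≤s z≤n)) 2n≤oX))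
  hop-X i false eq 3 _ _ = hop₀ (hop-last (X∈ false i eq (there (here refl))))
  hop-X i b eq (suc (suc (suc (suc _)))) _ (s≤s (s≤s (s≤s ())))

  hop-Y : ∀ j b → inC (p j) ≡ b → (b ≡ false → inC (q j) ≡ true) →
    ∀ t → 1 ≤ t → t ≤ 9 → Hop≤1 (Y j t)
  hop-Y j true eq _ 1 _ _ = via 0 (Y∈ true j eq (here refl)) refl (Y-< j 1 1)
    (X<Y (p j) j 0 (s≤s z≤n)) (hop-X₁ (p j))
  hop-Y j true eq _ 2 _ _ = via 1 (Y∈ true j eq (here refl)) refl (Y-< j 2 0)
    (X<Y (p j) j 0 (s≤s (s≤s z≤n))) (hop-X₂ (p j) eq)
  hop-Y j true eq _ 3 _ _ = hop₀ (hop-last (Y∈ true j eq (here refl)))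
  hop-Y j true eq _ 4 _ _ = hop₀ (hop-last (Y∈ true j eq (there (here refl))))
  hop-Y j true eq _ 5 _ _ = via 0 (Y∈ true j eq (there (there (here refl)))) refl (Y-< j 5 0)
    (X<Y (q j) j 4 (s≤s z≤n)) (hop-X₁ (q j))
  hop-Y j true eq _ 6 _ _ = hop₀ (hop-last (Y∈ true j eq (there (there (here refl)))))
  hop-Y j true eq _ 7 _ _ = via 0 (Y∈ true j eq (there (there (there (here refl))))) refl (Y-< j 7 1)
    (Y-< j 3 3) (hop-last (Y∈ true j eq (here refl)))
  hop-Y j true eq _ 8 _ _ = via 1 (Y∈ true j eq (there (there (there (here refl))))) refl (Y-< j 8 0)
    (Y-< j 4 2) (hop-last (Y∈ true j eq (there (here refl))))
  hop-Y j true eq _ 9 _ _ = hop₀ (hop-last (Y∈ true j eq (there (there (there (here refl))))))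
  hop-Y j false eq _ 1 _ _ = via 0 (Y∈ false j eq (here refl)) refl (Y-< j 1 0)
    (X<Y (p j) j 0 (s≤s z≤n)) (hop-X₁ (p j))
  hop-Y j false eq _ 2 _ _ = hop₀ (hop-last (Y∈ false j eq (here refl)))
  hop-Y j false eq _ 3 _ _ = via 0 (Y∈ false j eq (there (here refl))) refl (Y-< j 3 0)
    (P<Y j 2 (B≤oX j (s≤s z≤n))) (hop-P (s≤s z≤n) (B≤oX j (s≤s z≤n)))
  hop-Y j false eq _ 4 _ _ = hop₀ (hop-last (Y∈ false j eq (there (here refl))))
  hop-Y j false eq _ 5 _ _ = via 0 (Y∈ false j eq (there (there (here refl)))) refl (Y-< j 5 1)
    (X<Y (q j) j 4 (s≤s z≤n)) (hop-X₁ (q j))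
  hop-Y j false eq q∈C 6 _ _ = via 1 (Y∈ false j eq (there (there (here refl)))) refl (Y-< j 6 0)
    (X<Y (q j) j 4 (s≤s (s≤s z≤n))) (hop-X₂ (q j) (q∈C refl))
  hop-Y j false eq _ 7 _ _ = hop₀ (hop-last (Y∈ false j eq (there (there (here refl)))))
  hop-Y j false eq _ 8 _ _ = via 0 (Y∈ false j eq (there (there (there (here refl))))) refl (Y-< j 8 0)
    (Y-< j 4 3) (hop-last (Y∈ false j eq (there (here refl))))
  hop-Y j false eq _ 9 _ _ = hop₀ (hop-last (Y∈ false j eq (there (there (there (here refl))))))
  hop-Y j b eq _ (suc (suc (suc (suc (suc (suc (suc (suc (suc (suc _)))))))))) _
    (s≤s (s≤s (s≤s (s≤s (s≤s (s≤s (s≤s (s≤s (s≤s ())))))))))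

  q∈C : ∀ j → inC (p j) ≡ false → inC (q j) ≡ true
  q∈C j p∉C with isCover j
  ... | inj₁ p∈C = case trans (sym p∉C) ([]=⇒lookup p∈C) of λ ()
  ... | inj₂ q∈C = []=⇒lookup q∈C

  hop≤1 : ∀ x → 1 ≤ x → x ≤ length s → Hop≤1 x
  hop≤1 x 1≤x x≤ with region 1≤x (≤-trans x≤ (≤-reflexive length-s))
  ... | in-A i t _ t≤2 refl = hop₀ (hop-P 1≤x (≤-trans (A≤2n i t≤2) 2n≤oX))
  ... | in-B j t _ t≤2 refl = hop₀ (hop-P 1≤x (B≤oX j t≤2))
  ... | in-X i t 1≤t t≤3 refl = hop-X i (inC i) refl t 1≤t t≤3
  ... | in-Y j t 1≤t t≤9 refl = hop-Y j (inC (p j)) refl (q∈C j) t 1≤t t≤9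

  X-size : ∀ b i → length (X-phrases b i) ≡ 2 + 𝟙 (b Bool.≟ true)
  X-size true  i = refl
  X-size false i = refl

  Y-size : ∀ b j → length (Y-phrases b j) ≡ 4
  Y-size true  j = refl
  Y-size false j = refl

  size-parsing : size parsing ≡ 4 * n + 6 * m + ∣ C ∣
  size-parsing = begin
    length (P-part ++ X-part ++ Y-part)
      ≡⟨ length-++ P-part ⟩
    length P-part + length (X-part ++ Y-part)
      ≡⟨ cong₂ _+_ (length-replicate oX) (length-++ X-part) ⟩
    oX + (length X-part + length Y-part)
      ≡⟨ cong (λ l → oX + (l + length Y-part)) (begin
           length X-part          ≡⟨ length-concatMap X-block id ⟩
           ∑ n (λ i → length (X-block i))                 ≡⟨ ∑-cong n (λ i → X-size (inC i) i) ⟩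
           ∑ n (λ i → 2 + 𝟙 (inC i Bool.≟ true))          ≡⟨ ∑-const+ n 2 _ ⟩
           2 * n + ∑ n (λ i → 𝟙 (inC i Bool.≟ true))      ≡⟨ cong (2 * n +_) (∑-lookup C) ⟩
           2 * n + ∣ C ∣ ∎) ⟩
    oX + (2 * n + ∣ C ∣ + length Y-part)
      ≡⟨ cong (λ l → oX + (2 * n + ∣ C ∣ + l))
              (length-concatMap-const 4 Y-block (λ j → Y-size (inC (p j)) j) id) ⟩
    oX + (2 * n + ∣ C ∣ + 4 * m)
      ≡⟨ ring n m ∣ C ∣ ⟩
    4 * n + 6 * m + ∣ C ∣ ∎
    where
    open ≡-Reasoning
    ring : ∀ n m c → 2 * n + 2 * m + (2 * n + c + 4 * m) ≡ 4 * n + 6 * m + c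
    ring = solve-∀

  isBLZ : IsBLZ 1 s parsing
  isBLZ = ((nonempty , total) , valid) , hop≤1

theorem1 : (n m : ℕ) (E : Edges n m) → IsSimple E → (k : ℕ) → k ≤ n →
  HasVertexCoverOfSize E k ⇔
    Σ Parsing (λ P → IsBLZ 1 (s1 E) P × size P ≡ 4 * n + 6 * m + k)
theorem1 n m E simple k k≤n = mk⇔ to from
  where
  to : HasVertexCoverOfSize E k → Σ Parsing (λ P → IsBLZ 1 (s1 E) P × size P ≡ 4 * n + 6 * m + k)
  to (C , ∣C∣≡k , isCover) = parsing , isBLZ , trans size-parsing (cong (4 * n + 6 * m +_) ∣C∣≡k)
    where open Construction E C isCover

  from : Σ Parsing (λ P → IsBLZ 1 (s1 E) P × size P ≡ 4 * n + 6 * m + k) → HasVertexCoverOfSize E k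
  from (P , blz , size≡) = LowerBound.vertex-cover E simple P blz size≡ k≤n
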